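{- Let $m,n$ be integers with $n>3m\geq 3$. Then there is a Latin trade $T_{m,n}$ in $B_n$ such that $T_0:=\{(0,0;0),(m,0;m),(m,m;2m),(0,m;m)\}\subseteq T_{m,n}$, and every $(r,c;r+c)\in T_{m,n}\setminus T_0$ satisfies $0\leq r\leq m$ and $2m\leq c\leq n-m$.
   Context: $B_n=\{(i,j;i+j \bmod n): i,j\in\mathbb{Z}_n\}$ is the addition table of $\mathbb{Z}_n$, as triples (row, column; symbol), with rows and columns identified with $\{0,1,\dots,n-1\}$ and symbols taken mod $n$. A partial Latin square (PLS) is an array in which some cells may be empty and each symbol occurs at most once per row and column. A Latin trade in $B_n$ is a non-empty PLS $T\subseteq B_n$ for which there is a PLS $T'$ of the same order with $T\cap T'=\emptyset$, the same set of non-empty cells as $T$, and the same set of symbols as $T$ in each row and in each column. -}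

module Defs where

open import Data.Nat using (ℕ; zero; suc; _+_; _*_; _∸_; _≤_; _<_)
open import Data.Nat.DivMod using (_%_)
open import Data.Fin using (Fin; toℕ)
open import Data.Maybe using (Maybe; just; nothing)
open import Data.Product using (Σ; ∃; ∃-syntax; _×_; _,_)
open import Data.Sum using (_⊎_)
open import Relation.Binary.PropositionalEquality using (_≡_; _≢_)
open import Relation.Nullary using (¬_)
open import Function.Bundles using (_⇔_)

-- A triple (r,c;s) belongs to A iff A r c ≡ just s.
Array : ℕ → Set
Array n = Fin n → Fin n → Maybe (Fin n)

IsPLS : ∀ {n} → Array n → Set
IsPLS {n} A =
  (∀ (r c c' s : Fin n) → A r c ≡ just s → A r c' ≡ just s → c ≡ c') ×
  (∀ (r r' c s : Fin n) → A r c ≡ just s → A r' c ≡ just s → r ≡ r')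

addMod : ∀ {n} → Fin n → Fin n → ℕ
addMod {suc k} r c = (toℕ r + toℕ c) % suc k

-- A ⊆ B_n : every triple of A is of the form (i,j; i+j mod n)
SubB : ∀ {n} → Array n → Set
SubB {n} A = ∀ (r c s : Fin n) → A r c ≡ just s → toℕ s ≡ addMod r c

NonEmpty : ∀ {n} → Array n → Set
NonEmpty {n} A = ∃[ r ] ∃[ c ] ∃[ s ] (A r c ≡ just s)

Filled : ∀ {n} → Array n → Fin n → Fin n → Set
Filled A r c = ∃[ s ] (A r c ≡ just s)

IsMate : ∀ {n} → Array n → Array n → Set
IsMate {n} T T' =
  IsPLS T' ×
  (∀ (r c s : Fin n) → T r c ≡ just s → T' r c ≡ just s → Data.Empty.⊥) ×
  (∀ (r c : Fin n) → Filled T r c ⇔ Filled T' r c) ×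
  (∀ (r s : Fin n) → (∃[ c ] (T r c ≡ just s)) ⇔ (∃[ c ] (T' r c ≡ just s))) ×
  (∀ (c s : Fin n) → (∃[ r ] (T r c ≡ just s)) ⇔ (∃[ r ] (T' r c ≡ just s)))
  where import Data.Empty

IsLatinTradeInB : ∀ {n} → Array n → Set
IsLatinTradeInB {n} T = NonEmpty T × IsPLS T × SubB T × ∃[ T' ] IsMate T T'

HasEntry : ∀ {n} → Array n → ℕ → ℕ → ℕ → Set
HasEntry {n} A r c s =
  ∃[ fr ] ∃[ fc ] ∃[ fs ] (toℕ fr ≡ r × toℕ fc ≡ c × toℕ fs ≡ s × A fr fc ≡ just fs)

InT0 : ℕ → ℕ → ℕ → ℕ → Set
InT0 m r c s =
  (r ≡ 0 × c ≡ 0 × s ≡ 0) ⊎ (r ≡ m × c ≡ 0 × s ≡ m) ⊎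
  (r ≡ m × c ≡ m × s ≡ 2 * m) ⊎ (r ≡ 0 × c ≡ m × s ≡ m)

{-# OPTIONS --safe #-}
-- Work in the addition table of ℕ and reduce modulo n only at the end.  The
-- four cells of T₀ force the mate on the columns 0 and m; what is left is a
-- "bridge": a partial trade in the rows 0 … m and the columns 2m … n - m which,
-- in row 0, trades the symbol 2m for n and, in row m, trades n for 2m.  Bridges
-- glue side by side and one above the other, so they are built by the
-- Euclidean algorithm from column swaps (two-cell trades in one column).  Only
-- height h < length L < 2h does not fit into the allowed columns this way; it is
-- handled by a two-column ladder whose leftover imbalance is a smaller bridge.
-- Modulo n the symbols 0 and n coincide and the bridge closes up to a trade.
module Submission where

open import Defs
open import Data.Nat using (ℕ; zero; suc; _+_; _*_; _∸_; _≤_; _<_; z≤n; s≤s; _≟_; _<?_; _≤?_; NonZero; >-nonZero)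
open import Data.Nat.Properties
open import Algebra.Properties.CommutativeSemigroup +-commutativeSemigroup using (interchange; xy∙z≈xz∙y)
open import Data.Nat.DivMod using (_%_; _/_; _mod_; m<n⇒m%n≡m; n%n≡0; m≡m%n+[m/n]*n; m%n<n; m≥n⇒m/n>0)
open import Data.Nat.Tactic.RingSolver using (solve)
open import Data.Fin using (Fin; toℕ; fromℕ<)
open import Data.Fin.Properties using (toℕ-fromℕ<; toℕ-injective)
open import Data.Maybe using (Maybe; just; nothing)
open import Data.Maybe.Properties using (just-injective)
open import Data.List using (_∷_; [])
open import Data.Product using (∃; ∃-syntax; _×_; _,_; proj₁; proj₂)
open import Data.Sum using (_⊎_; inj₁; inj₂)
import Data.Sum as Sum
open import Data.Empty using (⊥; ⊥-elim)
open import Function using (_∘_; id)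
open import Function.Bundles using (_⇔_; mk⇔)
open import Relation.Binary using (tri<; tri≈; tri>)
open import Relation.Binary.PropositionalEquality
open import Relation.Nullary using (¬_; yes; no)

-- g r c ≡ just t: the cell (r , c), holding r + c, is in the trade and holds t in its mate.
Patch : Set
Patch = ℕ → ℕ → Maybe ℕ

Occupied : Patch → ℕ → ℕ → Set
Occupied g r c = ∃ λ t → g r c ≡ just t

empty : Patch
empty _ _ = nothing

Disjoint : Patch → Patch → Set
Disjoint g₁ g₂ = ∀ {r c} → Occupied g₁ r c → Occupied g₂ r c → ⊥

opaque
  _∪_ : Patch → Patch → Patch
  (g₁ ∪ g₂) r c with g₁ r c
  ... | just t = just t
  ... | nothing = g₂ r c

  ∪-cases : ∀ g₁ g₂ {r c t} → (g₁ ∪ g₂) r c ≡ just t → g₁ r c ≡ just t ⊎ g₂ r c ≡ just t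
  ∪-cases g₁ g₂ {r} {c} eq with g₁ r c
  ... | just _ = inj₁ eq
  ... | nothing = inj₂ eq

  ∪-introˡ : ∀ g₁ g₂ {r c t} → g₁ r c ≡ just t → (g₁ ∪ g₂) r c ≡ just t
  ∪-introˡ g₁ g₂ {r} {c} eq with g₁ r c
  ... | just _ = eq
  ∪-introˡ g₁ g₂ () | nothing

  ∪-introʳ : ∀ g₁ g₂ {r c t} → ¬ Occupied g₁ r c → g₂ r c ≡ just t → (g₁ ∪ g₂) r c ≡ just t
  ∪-introʳ g₁ g₂ {r} {c} free eq with g₁ r c
  ... | just u = ⊥-elim (free (u , refl))
  ... | nothing = eq

∪-occupied : ∀ g₁ g₂ {r c} → Occupied (g₁ ∪ g₂) r c → Occupied g₁ r c ⊎ Occupied g₂ r c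
∪-occupied g₁ g₂ (t , eq) = Sum.map (t ,_) (t ,_) (∪-cases g₁ g₂ eq)

Port : Set₁
Port = ℕ → ℕ → Set

-- A gadget is a Latin bitrade except in its ports: I r s says that the symbol s
-- of row r is missing from the mate, O r t that the mate's row r has the extra t.
record Gadget (g : Patch) (I O : Port) : Set where
  field
    moved      : ∀ {r c t} → g r c ≡ just t → t ≢ r + c
    col-⊆      : ∀ {r c t} → g r c ≡ just t → ∃ λ r₁ → Occupied g r₁ c × r₁ + c ≡ t
    col-inj    : ∀ {r r₁ c t} → g r c ≡ just t → g r₁ c ≡ just t → r ≡ r₁
    col-⊇      : ∀ {r c} → Occupied g r c → ∃ λ r₁ → g r₁ c ≡ just (r + c)
    row-⊆      : ∀ {r c t} → g r c ≡ just t → (∃ λ c₁ → Occupied g r c₁ × r + c₁ ≡ t) ⊎ O r t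
    row-inj    : ∀ {r c c₁ t} → g r c ≡ just t → g r c₁ ≡ just t → c ≡ c₁
    row-⊇      : ∀ {r c} → Occupied g r c → I r (r + c) ⊎ (∃ λ c₁ → g r c₁ ≡ just (r + c))
    out-placed : ∀ {r t} → O r t → ∃ λ c → g r c ≡ just t
    in-present : ∀ {r s} → I r s → ∃ λ c → Occupied g r c × r + c ≡ s
    in-absent  : ∀ {r s c} → I r s → g r c ≡ just s → ⊥

gadget-resp : ∀ {g I O I′ O′} → Gadget g I O →
  (∀ {r s} → I r s → I′ r s) → (∀ {r s} → I′ r s → I r s) →
  (∀ {r s} → O r s → O′ r s) → (∀ {r s} → O′ r s → O r s) → Gadget g I′ O′
gadget-resp G I⇒I′ I′⇒I O⇒O′ O′⇒O = record
  { moved = moved ; col-⊆ = col-⊆ ; col-inj = col-inj ; col-⊇ = col-⊇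
  ; row-⊆ = Sum.map id O⇒O′ ∘ row-⊆
  ; row-inj = row-inj
  ; row-⊇ = Sum.map I⇒I′ id ∘ row-⊇
  ; out-placed = out-placed ∘ O′⇒O
  ; in-present = in-present ∘ I′⇒I
  ; in-absent = in-absent ∘ I′⇒I }
  where open Gadget G

-- The ports of two gadgets cancel down to I and O: an output of one gadget is an
-- input of the other or an output of the union, and likewise for inputs.
record Glue (g₁ g₂ : Patch) (I₁ O₁ I₂ O₂ I O : Port) : Set where
  field
    out₁-glued   : ∀ {r t} → O₁ r t → I₂ r t ⊎ O r t
    out₂-glued   : ∀ {r t} → O₂ r t → I₁ r t ⊎ O r t
    out₁-in₂     : ∀ {r c t} → O₁ r t → Occupied g₂ r c → r + c ≡ t → I₂ r t
    out₂-in₁     : ∀ {r c t} → O₂ r t → Occupied g₁ r c → r + c ≡ t → I₁ r t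
    outs-apart   : ∀ {r t} → O₁ r t → O₂ r t → ⊥
    in₁-glued    : ∀ {r s} → I₁ r s → I r s ⊎ O₂ r s
    in₂-glued    : ∀ {r s} → I₂ r s → I r s ⊎ O₁ r s
    out-split    : ∀ {r t} → O r t → O₁ r t ⊎ O₂ r t
    in-split     : ∀ {r s} → I r s → I₁ r s ⊎ I₂ r s
    out₁-not-in  : ∀ {r s} → O₁ r s → I r s → ⊥
    out₂-not-in  : ∀ {r s} → O₂ r s → I r s → ⊥

module UnionGadget {g₁ g₂ : Patch} {I₁ O₁ I₂ O₂ I O : Port} (G₁ : Gadget g₁ I₁ O₁) (G₂ : Gadget g₂ I₂ O₂)
  (apart : Disjoint g₁ g₂) (glue : Glue g₁ g₂ I₁ O₁ I₂ O₂ I O) where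
  module G₁ = Gadget G₁
  module G₂ = Gadget G₂
  open Glue glue
  g : Patch
  g = g₁ ∪ g₂
  cases : ∀ {r c t} → g r c ≡ just t → g₁ r c ≡ just t ⊎ g₂ r c ≡ just t
  cases = ∪-cases g₁ g₂
  inˡ : ∀ {r c t} → g₁ r c ≡ just t → g r c ≡ just t
  inˡ = ∪-introˡ g₁ g₂
  inʳ : ∀ {r c t} → g₂ r c ≡ just t → g r c ≡ just t
  inʳ e = ∪-introʳ g₁ g₂ (λ o → apart o (_ , e)) e
  occˡ : ∀ {r c} → Occupied g₁ r c → Occupied g r c
  occˡ (t , e) = t , inˡ e
  occʳ : ∀ {r c} → Occupied g₂ r c → Occupied g r c
  occʳ (t , e) = t , inʳ e

  moved : ∀ {r c t} → g r c ≡ just t → t ≢ r + c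
  moved eq with cases eq
  ... | inj₁ e = G₁.moved e
  ... | inj₂ e = G₂.moved e
  col-⊆ : ∀ {r c t} → g r c ≡ just t → ∃ λ r₁ → Occupied g r₁ c × r₁ + c ≡ t
  col-⊆ eq with cases eq
  ... | inj₁ e = let (r₁ , o , q) = G₁.col-⊆ e in r₁ , occˡ o , q
  ... | inj₂ e = let (r₁ , o , q) = G₂.col-⊆ e in r₁ , occʳ o , q
  col-clash : ∀ {r r₁ c t} → g₁ r c ≡ just t → g₂ r₁ c ≡ just t → ⊥
  col-clash e₁ e₂ with G₁.col-⊆ e₁ | G₂.col-⊆ e₂
  ... | (ra , oa , qa) | (rb , ob , qb) with +-cancelʳ-≡ _ ra rb (trans qa (sym qb))
  ... | refl = apart oa ob
  col-inj : ∀ {r r₁ c t} → g r c ≡ just t → g r₁ c ≡ just t → r ≡ r₁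
  col-inj e e′ with cases e | cases e′
  ... | inj₁ a | inj₁ b = G₁.col-inj a b
  ... | inj₂ a | inj₂ b = G₂.col-inj a b
  ... | inj₁ a | inj₂ b = ⊥-elim (col-clash a b)
  ... | inj₂ a | inj₁ b = ⊥-elim (col-clash b a)
  col-⊇ : ∀ {r c} → Occupied g r c → ∃ λ r₁ → g r₁ c ≡ just (r + c)
  col-⊇ o with ∪-occupied g₁ g₂ o
  ... | inj₁ o₁ = let (r₁ , e) = G₁.col-⊇ o₁ in r₁ , inˡ e
  ... | inj₂ o₂ = let (r₁ , e) = G₂.col-⊇ o₂ in r₁ , inʳ e
  row-⊆ : ∀ {r c t} → g r c ≡ just t → (∃ λ c₁ → Occupied g r c₁ × r + c₁ ≡ t) ⊎ O r t
  row-⊆ eq with cases eq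
  ... | inj₁ e with G₁.row-⊆ e
  ...   | inj₁ (c₁ , o , q) = inj₁ (c₁ , occˡ o , q)
  ...   | inj₂ o₁ with out₁-glued o₁
  ...     | inj₂ o = inj₂ o
  ...     | inj₁ i₂ = let (c₁ , o , q) = G₂.in-present i₂ in inj₁ (c₁ , occʳ o , q)
  row-⊆ eq | inj₂ e with G₂.row-⊆ e
  ...   | inj₁ (c₁ , o , q) = inj₁ (c₁ , occʳ o , q)
  ...   | inj₂ o₂ with out₂-glued o₂
  ...     | inj₂ o = inj₂ o
  ...     | inj₁ i₁ = let (c₁ , o , q) = G₁.in-present i₁ in inj₁ (c₁ , occˡ o , q)
  row-clash : ∀ {r c c₁ t} → g₁ r c ≡ just t → g₂ r c₁ ≡ just t → ⊥
  row-clash e₁ e₂ with G₁.row-⊆ e₁ | G₂.row-⊆ e₂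
  ... | inj₁ (ca , oa , qa) | inj₁ (cb , ob , qb) with +-cancelˡ-≡ _ ca cb (trans qa (sym qb))
  ... | refl = apart oa ob
  row-clash e₁ e₂ | inj₁ (ca , oa , qa) | inj₂ o₂ = G₁.in-absent (out₂-in₁ o₂ oa qa) e₁
  row-clash e₁ e₂ | inj₂ o₁ | inj₁ (cb , ob , qb) = G₂.in-absent (out₁-in₂ o₁ ob qb) e₂
  row-clash e₁ e₂ | inj₂ o₁ | inj₂ o₂ = outs-apart o₁ o₂
  row-inj : ∀ {r c c₁ t} → g r c ≡ just t → g r c₁ ≡ just t → c ≡ c₁
  row-inj e e′ with cases e | cases e′
  ... | inj₁ a | inj₁ b = G₁.row-inj a b
  ... | inj₂ a | inj₂ b = G₂.row-inj a b
  ... | inj₁ a | inj₂ b = ⊥-elim (row-clash a b)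
  ... | inj₂ a | inj₁ b = ⊥-elim (row-clash b a)
  row-⊇ : ∀ {r c} → Occupied g r c → I r (r + c) ⊎ (∃ λ c₁ → g r c₁ ≡ just (r + c))
  row-⊇ o with ∪-occupied g₁ g₂ o
  ... | inj₁ o₁ with G₁.row-⊇ o₁
  ...   | inj₂ (c₁ , e) = inj₂ (c₁ , inˡ e)
  ...   | inj₁ i₁ with in₁-glued i₁
  ...     | inj₁ i = inj₁ i
  ...     | inj₂ o₂ = let (c₁ , e) = G₂.out-placed o₂ in inj₂ (c₁ , inʳ e)
  row-⊇ o | inj₂ o₂ with G₂.row-⊇ o₂
  ...   | inj₂ (c₁ , e) = inj₂ (c₁ , inʳ e)
  ...   | inj₁ i₂ with in₂-glued i₂
  ...     | inj₁ i = inj₁ i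
  ...     | inj₂ o₁ = let (c₁ , e) = G₁.out-placed o₁ in inj₂ (c₁ , inˡ e)
  out-placed : ∀ {r t} → O r t → ∃ λ c → g r c ≡ just t
  out-placed o with out-split o
  ... | inj₁ o₁ = let (c , e) = G₁.out-placed o₁ in c , inˡ e
  ... | inj₂ o₂ = let (c , e) = G₂.out-placed o₂ in c , inʳ e
  in-present : ∀ {r s} → I r s → ∃ λ c → Occupied g r c × r + c ≡ s
  in-present i with in-split i
  ... | inj₁ i₁ = let (c , o , q) = G₁.in-present i₁ in c , occˡ o , q
  ... | inj₂ i₂ = let (c , o , q) = G₂.in-present i₂ in c , occʳ o , q
  in-absent : ∀ {r s c} → I r s → g r c ≡ just s → ⊥
  in-absent i eq with cases eq | in-split i
  ... | inj₁ e | inj₁ i₁ = G₁.in-absent i₁ e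
  ... | inj₂ e | inj₂ i₂ = G₂.in-absent i₂ e
  ... | inj₁ e | inj₂ i₂ with G₁.row-⊆ e
  ...   | inj₂ o₁ = out₁-not-in o₁ i
  ...   | inj₁ (ca , oa , qa) with G₂.in-present i₂
  ...     | (cb , ob , qb) with +-cancelˡ-≡ _ ca cb (trans qa (sym qb))
  ...       | refl = apart oa ob
  in-absent i eq | inj₂ e | inj₁ i₁ with G₂.row-⊆ e
  ...   | inj₂ o₂ = out₂-not-in o₂ i
  ...   | inj₁ (cb , ob , qb) with G₁.in-present i₁
  ...     | (ca , oa , qa) with +-cancelˡ-≡ _ ca cb (trans qa (sym qb))
  ...       | refl = apart oa ob

∪-gadget : ∀ {g₁ g₂ I₁ O₁ I₂ O₂ I O} → Gadget g₁ I₁ O₁ → Gadget g₂ I₂ O₂ → Disjoint g₁ g₂ →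
           Glue g₁ g₂ I₁ O₁ I₂ O₂ I O → Gadget (g₁ ∪ g₂) I O
∪-gadget G₁ G₂ apart glue = record
  { moved = moved ; col-⊆ = col-⊆ ; col-inj = col-inj ; col-⊇ = col-⊇
  ; row-⊆ = row-⊆ ; row-inj = row-inj ; row-⊇ = row-⊇ ; out-placed = out-placed
  ; in-present = in-present ; in-absent = in-absent }
  where open UnionGadget G₁ G₂ apart glue

m≢m+n : ∀ m {n} → 0 < n → m ≢ m + n
m≢m+n m n>0 = <⇒≢ (m<m+n m n>0)

-- In a bridge of height h and length L at (a , x) the mate replaces the symbol
-- a + x of row a by a + x + L, and the symbol a + x + L of row a + h by a + x.
Ins : ℕ → ℕ → ℕ → ℕ → Port
Ins h L a x r s = (r ≡ a × s ≡ a + x) ⊎ (r ≡ a + h × s ≡ a + x + L)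

Outs : ℕ → ℕ → ℕ → ℕ → Port
Outs h L a x r t = (r ≡ a × t ≡ a + x + L) ⊎ (r ≡ a + h × t ≡ a + x)

Bridge : ℕ → ℕ → ℕ → ℕ → Patch → Set
Bridge h L a x g = Gadget g (Ins h L a x) (Outs h L a x)

opaque
  columnSwap : ℕ → ℕ → ℕ → Patch
  columnSwap d a x r c with c ≟ x
  ... | no _ = nothing
  ... | yes _ with r ≟ a
  ...   | yes _ = just (a + x + d)
  ...   | no _ with r ≟ a + d
  ...     | yes _ = just (a + x)
  ...     | no _ = nothing

  columnSwap-cases : ∀ d a x {r c t} → columnSwap d a x r c ≡ just t →
    c ≡ x × ((r ≡ a × t ≡ a + x + d) ⊎ (r ≡ a + d × t ≡ a + x))
  columnSwap-cases d a x {r} {c} eq with c ≟ x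
  columnSwap-cases d a x () | no _
  ... | yes p with r ≟ a
  ...   | yes q = p , inj₁ (q , sym (just-injective eq))
  ...   | no _ with r ≟ a + d
  ...     | yes q = p , inj₂ (q , sym (just-injective eq))
  columnSwap-cases d a x () | yes p | no _ | no _

  columnSwap-top : ∀ d a x → columnSwap d a x a x ≡ just (a + x + d)
  columnSwap-top d a x with x ≟ x
  ... | no x≢x = ⊥-elim (x≢x refl)
  ... | yes _ with a ≟ a
  ...   | yes _ = refl
  ...   | no a≢a = ⊥-elim (a≢a refl)

  columnSwap-bottom : ∀ {d} a x → 0 < d → columnSwap d a x (a + d) x ≡ just (a + x)
  columnSwap-bottom {d} a x d>0 with x ≟ x
  ... | no x≢x = ⊥-elim (x≢x refl)
  ... | yes _ with a + d ≟ a
  ...   | yes e = ⊥-elim (m≢m+n a d>0 (sym e))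
  ...   | no _ with a + d ≟ a + d
  ...     | yes _ = refl
  ...     | no ≢ = ⊥-elim (≢ refl)

columnSwap-column : ∀ d a x {r c t} → columnSwap d a x r c ≡ just t → c ≡ x × a ≤ r × r ≤ a + d
columnSwap-column d a x e with columnSwap-cases d a x e
... | refl , inj₁ (refl , _) = refl , ≤-refl , m≤m+n a d
... | refl , inj₂ (refl , _) = refl , m≤m+n a d , ≤-refl

module ColumnSwapBridge {d : ℕ} (a x : ℕ) (d>0 : 0 < d) where
  g : Patch
  g = columnSwap d a x
  cases : ∀ {r c t} → g r c ≡ just t → c ≡ x × ((r ≡ a × t ≡ a + x + d) ⊎ (r ≡ a + d × t ≡ a + x))
  cases = columnSwap-cases d a x
  top : g a x ≡ just (a + x + d)
  top = columnSwap-top d a x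
  bottom : g (a + d) x ≡ just (a + x)
  bottom = columnSwap-bottom a x d>0
  comm : a + d + x ≡ a + x + d
  comm = xy∙z≈xz∙y a d x
  symbols≢ : a + x ≢ a + x + d
  symbols≢ = m≢m+n (a + x) d>0
  rows≢ : a ≢ a + d
  rows≢ = m≢m+n a d>0

  moved : ∀ {r c t} → g r c ≡ just t → t ≢ r + c
  moved eq with cases eq
  ... | refl , inj₁ (refl , refl) = symbols≢ ∘ sym
  ... | refl , inj₂ (refl , refl) = λ e → symbols≢ (trans e comm)
  col-⊆ : ∀ {r c t} → g r c ≡ just t → ∃ λ r₁ → Occupied g r₁ c × r₁ + c ≡ t
  col-⊆ eq with cases eq
  ... | refl , inj₁ (refl , refl) = a + d , (_ , bottom) , comm
  ... | refl , inj₂ (refl , refl) = a , (_ , top) , refl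
  col-inj : ∀ {r r₁ c t} → g r c ≡ just t → g r₁ c ≡ just t → r ≡ r₁
  col-inj e e′ with cases e | cases e′
  ... | refl , inj₁ (refl , refl) | refl , inj₁ (refl , _) = refl
  ... | refl , inj₂ (refl , refl) | refl , inj₂ (refl , _) = refl
  ... | refl , inj₁ (refl , refl) | refl , inj₂ (refl , q) = ⊥-elim (symbols≢ (sym q))
  ... | refl , inj₂ (refl , refl) | refl , inj₁ (refl , q) = ⊥-elim (symbols≢ q)
  col-⊇ : ∀ {r c} → Occupied g r c → ∃ λ r₁ → g r₁ c ≡ just (r + c)
  col-⊇ (_ , eq) with cases eq
  ... | refl , inj₁ (refl , refl) = a + d , bottom
  ... | refl , inj₂ (refl , refl) = a , trans top (cong just (sym comm))
  row-⊆ : ∀ {r c t} → g r c ≡ just t → (∃ λ c₁ → Occupied g r c₁ × r + c₁ ≡ t) ⊎ Outs d d a x r t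
  row-⊆ eq with cases eq
  ... | refl , inj₁ (refl , refl) = inj₂ (inj₁ (refl , refl))
  ... | refl , inj₂ (refl , refl) = inj₂ (inj₂ (refl , refl))
  row-inj : ∀ {r c c₁ t} → g r c ≡ just t → g r c₁ ≡ just t → c ≡ c₁
  row-inj e e′ with cases e | cases e′
  ... | refl , _ | refl , _ = refl
  row-⊇ : ∀ {r c} → Occupied g r c → Ins d d a x r (r + c) ⊎ (∃ λ c₁ → g r c₁ ≡ just (r + c))
  row-⊇ (_ , eq) with cases eq
  ... | refl , inj₁ (refl , refl) = inj₁ (inj₁ (refl , refl))
  ... | refl , inj₂ (refl , refl) = inj₁ (inj₂ (refl , comm))
  out-placed : ∀ {r t} → Outs d d a x r t → ∃ λ c → g r c ≡ just t
  out-placed (inj₁ (refl , refl)) = x , top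
  out-placed (inj₂ (refl , refl)) = x , bottom
  in-present : ∀ {r s} → Ins d d a x r s → ∃ λ c → Occupied g r c × r + c ≡ s
  in-present (inj₁ (refl , refl)) = x , (_ , top) , refl
  in-present (inj₂ (refl , refl)) = x , (_ , bottom) , comm
  in-absent : ∀ {r s c} → Ins d d a x r s → g r c ≡ just s → ⊥
  in-absent (inj₁ (refl , refl)) eq with cases eq
  ... | refl , inj₁ (_ , q) = symbols≢ q
  ... | refl , inj₂ (q , _) = rows≢ q
  in-absent (inj₂ (refl , refl)) eq with cases eq
  ... | refl , inj₁ (q , _) = rows≢ (sym q)
  ... | refl , inj₂ (_ , q) = symbols≢ (sym q)

columnSwap-bridge : ∀ {d} a x → 0 < d → Bridge d d a x (columnSwap d a x)
columnSwap-bridge a x d>0 = record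
  { moved = moved ; col-⊆ = col-⊆ ; col-inj = col-inj ; col-⊇ = col-⊇
  ; row-⊆ = row-⊆ ; row-inj = row-inj ; row-⊇ = row-⊇ ; out-placed = out-placed
  ; in-present = in-present ; in-absent = in-absent }
  where open ColumnSwapBridge a x d>0

bridge-widen : ∀ {g h L} a x → 0 < h → 0 < L → Bridge h L a (x + h) g →
  (∀ {r c t} → g r c ≡ just t → x < c) →
  Bridge h (h + L) a x (columnSwap h a x ∪ g)
bridge-widen {g} {h} {L} a x h>0 L>0 G right = ∪-gadget (columnSwap-bridge a x h>0) G apart glue
  where
  apart : Disjoint (columnSwap h a x) g
  apart (_ , e) (_ , e′) with columnSwap-cases h a x e
  ... | refl , _ = <-irrefl refl (right e′)
  assoc : a + x + h ≡ a + (x + h)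
  assoc = +-assoc a x h
  far : a + (x + h) + L ≡ a + x + (h + L)
  far = solve (a ∷ x ∷ h ∷ L ∷ [])
  row≢ : ∀ {r} → r ≡ a → r ≢ a + h
  row≢ refl = m≢m+n a h>0
  s₀≢s₁ : a + x ≢ a + (x + h)
  s₀≢s₁ e = m≢m+n (a + x) h>0 (trans e (sym assoc))
  s₀≢s₂ : a + x ≢ a + x + (h + L)
  s₀≢s₂ = m≢m+n (a + x) (<-≤-trans h>0 (m≤m+n h L))
  s₁≢s₂ : a + (x + h) ≢ a + x + (h + L)
  s₁≢s₂ e = m≢m+n (a + (x + h)) L>0 (trans e (sym far))
  glue : Glue (columnSwap h a x) g (Ins h h a x) (Outs h h a x) (Ins h L a (x + h)) (Outs h L a (x + h))
              (Ins h (h + L) a x) (Outs h (h + L) a x)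
  glue = record
    { out₁-glued = λ { (inj₁ (refl , refl)) → inj₁ (inj₁ (refl , assoc))
                     ; (inj₂ (refl , refl)) → inj₂ (inj₂ (refl , refl)) }
    ; out₂-glued = λ { (inj₁ (refl , refl)) → inj₂ (inj₁ (refl , far))
                     ; (inj₂ (refl , refl)) → inj₁ (inj₂ (refl , sym assoc)) }
    ; out₁-in₂ = λ { (inj₁ (refl , refl)) _ _ → inj₁ (refl , assoc)
                   ; (inj₂ (refl , refl)) (_ , e) q →
                       ⊥-elim (<⇒≢ (+-mono-≤-< (m≤m+n a h) (right e)) (sym q)) }
    ; out₂-in₁ = λ { (inj₁ (refl , refl)) (_ , e) q → ⊥-elim (on-top e q)
                   ; (inj₂ (refl , refl)) _ _ → inj₂ (refl , sym assoc) }
    ; outs-apart = λ { (inj₁ (refl , refl)) (inj₁ (_ , q)) → s₁≢s₂ (trans (sym assoc) (trans q far))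
                     ; (inj₁ (p , _)) (inj₂ (p′ , _)) → row≢ p p′
                     ; (inj₂ (p , _)) (inj₁ (p′ , _)) → row≢ p′ p
                     ; (inj₂ (refl , refl)) (inj₂ (_ , q)) → s₀≢s₁ q }
    ; in₁-glued = λ { (inj₁ (refl , refl)) → inj₁ (inj₁ (refl , refl))
                    ; (inj₂ (refl , refl)) → inj₂ (inj₂ (refl , assoc)) }
    ; in₂-glued = λ { (inj₁ (refl , refl)) → inj₂ (inj₁ (refl , sym assoc))
                    ; (inj₂ (refl , refl)) → inj₁ (inj₂ (refl , far)) }
    ; out-split = λ { (inj₁ (refl , refl)) → inj₂ (inj₁ (refl , sym far))
                    ; (inj₂ (refl , refl)) → inj₁ (inj₂ (refl , refl)) }
    ; in-split = λ { (inj₁ (refl , refl)) → inj₁ (inj₁ (refl , refl))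
                   ; (inj₂ (refl , refl)) → inj₂ (inj₂ (refl , sym far)) }
    ; out₁-not-in = λ { (inj₁ (refl , refl)) (inj₁ (_ , q)) → s₀≢s₁ (trans (sym q) assoc)
                      ; (inj₁ (p , _)) (inj₂ (p′ , _)) → row≢ p p′
                      ; (inj₂ (p , _)) (inj₁ (p′ , _)) → row≢ p′ p
                      ; (inj₂ (refl , refl)) (inj₂ (_ , q)) → s₀≢s₂ q }
    ; out₂-not-in = λ { (inj₁ (refl , refl)) (inj₁ (_ , q)) → s₀≢s₂ (trans (sym q) far)
                      ; (inj₁ (p , _)) (inj₂ (p′ , _)) → row≢ p p′
                      ; (inj₂ (p , _)) (inj₁ (p′ , _)) → row≢ p′ p
                      ; (inj₂ (refl , refl)) (inj₂ (_ , q)) → s₁≢s₂ q }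
    }
    where
    on-top : ∀ {c t} → columnSwap h a x a c ≡ just t → a + c ≢ a + (x + h) + L
    on-top e q with columnSwap-cases h a x e
    ... | refl , _ = s₀≢s₂ (trans q far)

bridge-heighten : ∀ {g h L} a x → 0 < h → 0 < L → Bridge h L (a + L) x g →
  (∀ {r c t} → g r c ≡ just t → a + L ≤ r × c < x + L) →
  Bridge (L + h) L a (x + L) (columnSwap L a (x + L) ∪ g)
bridge-heighten {g} {h} {L} a x h>0 L>0 G below = ∪-gadget (columnSwap-bridge a (x + L) L>0) G apart glue
  where
  apart : Disjoint (columnSwap L a (x + L)) g
  apart (_ , e) (_ , e′) with columnSwap-cases L a (x + L) e
  ... | refl , _ = <-irrefl refl (proj₂ (below e′))
  shift : a + L + x ≡ a + (x + L)
  shift = solve (a ∷ L ∷ x ∷ [])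
  shift′ : a + L + x + L ≡ a + (x + L) + L
  shift′ = cong (_+ L) shift
  depth : a + L + h ≡ a + (L + h)
  depth = +-assoc a L h
  s≢s+L : a + (x + L) ≢ a + (x + L) + L
  s≢s+L = m≢m+n (a + (x + L)) L>0
  a≢aL : ∀ {r} → r ≡ a → r ≢ a + L
  a≢aL refl = m≢m+n a L>0
  aL≢aLh : ∀ {r} → r ≡ a + L → r ≢ a + L + h
  aL≢aLh refl = m≢m+n (a + L) h>0
  a≢aLh : ∀ {r} → r ≡ a → r ≢ a + L + h
  a≢aLh refl e = m≢m+n a (<-≤-trans L>0 (m≤m+n L h)) (trans e depth)
  glue : Glue (columnSwap L a (x + L)) g (Ins L L a (x + L)) (Outs L L a (x + L))
              (Ins h L (a + L) x) (Outs h L (a + L) x) (Ins (L + h) L a (x + L)) (Outs (L + h) L a (x + L))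
  glue = record
    { out₁-glued = λ { (inj₁ (refl , refl)) → inj₂ (inj₁ (refl , refl))
                     ; (inj₂ (refl , refl)) → inj₁ (inj₁ (refl , sym shift)) }
    ; out₂-glued = λ { (inj₁ (refl , refl)) → inj₁ (inj₂ (refl , shift′))
                     ; (inj₂ (refl , refl)) → inj₂ (inj₂ (depth , shift)) }
    ; out₁-in₂ = λ { (inj₁ (refl , refl)) (_ , e) _ → ⊥-elim (m+1+n≰m a (≤-trans (+-monoʳ-≤ a L>0) (proj₁ (below e))))
                   ; (inj₂ (refl , refl)) _ _ → inj₁ (refl , sym shift) }
    ; out₂-in₁ = λ { (inj₁ (refl , refl)) _ _ → inj₂ (refl , shift′)
                   ; (inj₂ (refl , refl)) (_ , e) _ → ⊥-elim (not-swapped e) }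
    ; outs-apart = λ { (inj₁ (p , _)) (inj₁ (p′ , _)) → a≢aL p p′
                     ; (inj₁ (p , _)) (inj₂ (p′ , _)) → a≢aLh p p′
                     ; (inj₂ (refl , refl)) (inj₁ (_ , q)) → s≢s+L (trans q shift′)
                     ; (inj₂ (p , _)) (inj₂ (p′ , _)) → aL≢aLh p p′ }
    ; in₁-glued = λ { (inj₁ (refl , refl)) → inj₁ (inj₁ (refl , refl))
                    ; (inj₂ (refl , refl)) → inj₂ (inj₁ (refl , sym shift′)) }
    ; in₂-glued = λ { (inj₁ (refl , refl)) → inj₂ (inj₂ (refl , shift))
                    ; (inj₂ (refl , refl)) → inj₁ (inj₂ (depth , shift′)) }
    ; out-split = λ { (inj₁ (refl , refl)) → inj₁ (inj₁ (refl , refl))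
                    ; (inj₂ (refl , refl)) → inj₂ (inj₂ (sym depth , sym shift)) }
    ; in-split = λ { (inj₁ (refl , refl)) → inj₁ (inj₁ (refl , refl))
                   ; (inj₂ (refl , refl)) → inj₂ (inj₂ (sym depth , sym shift′)) }
    ; out₁-not-in = λ { (inj₁ (refl , refl)) (inj₁ (_ , q)) → s≢s+L (sym q)
                      ; (inj₁ (p , _)) (inj₂ (p′ , _)) → a≢aLh p (trans p′ (sym depth))
                      ; (inj₂ (p , _)) (inj₁ (p′ , _)) → a≢aL p′ p
                      ; (inj₂ (p , _)) (inj₂ (p′ , _)) → aL≢aLh p (trans p′ (sym depth)) }
    ; out₂-not-in = λ { (inj₁ (p , _)) (inj₁ (p′ , _)) → a≢aL p′ p
                      ; (inj₁ (p , _)) (inj₂ (p′ , _)) → aL≢aLh p (trans p′ (sym depth))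
                      ; (inj₂ (p , _)) (inj₁ (p′ , _)) → a≢aLh p′ p
                      ; (inj₂ (refl , refl)) (inj₂ (_ , q)) → s≢s+L (trans (sym shift) q) }
    }
    where
    not-swapped : ∀ {c t} → columnSwap L a (x + L) (a + L + h) c ≡ just t → ⊥
    not-swapped e with columnSwap-cases L a (x + L) e
    ... | _ , inj₁ (p , _) = a≢aLh refl (sym p)
    ... | _ , inj₂ (p , _) = aL≢aLh refl (sym p)

LooselyPlaced : ℕ → ℕ → ℕ → ℕ → Patch → Set
LooselyPlaced h L a x g = ∀ {r c t} → g r c ≡ just t → a ≤ r × r ≤ a + h × x < c + h × c < x + L

TightlyPlaced : ℕ → ℕ → ℕ → ℕ → Patch → Set
TightlyPlaced h L a x g = ∀ {r c t} → g r c ≡ just t → a ≤ r × r ≤ a + h × x ≤ c × c + h ≤ x + L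

columnSwap-loosely : ∀ {h} a x → 0 < h → LooselyPlaced h h a x (columnSwap h a x)
columnSwap-loosely {h} a x h>0 e with columnSwap-column h a x e
... | refl , a≤r , r≤ = a≤r , r≤ , m<m+n x h>0 , m<m+n x h>0

columnSwap-tightly : ∀ {h} a x → TightlyPlaced h h a x (columnSwap h a x)
columnSwap-tightly {h} a x e with columnSwap-column h a x e
... | refl , a≤r , r≤ = a≤r , r≤ , ≤-refl , ≤-refl

widen-loosely : ∀ {g h L} a x → 0 < h → 0 < L → LooselyPlaced h L a (x + h) g →
  LooselyPlaced h (h + L) a x (columnSwap h a x ∪ g)
widen-loosely {g} {h} {L} a x h>0 L>0 placed {r} {c} e with ∪-cases (columnSwap h a x) g e
... | inj₁ e₁ with columnSwap-column h a x e₁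
...   | refl , a≤r , r≤ = a≤r , r≤ , m<m+n x h>0 , m<m+n x (<-≤-trans h>0 (m≤m+n h L))
widen-loosely {g} {h} {L} a x h>0 L>0 placed {r} {c} e | inj₂ e₂ =
  let (a≤r , r≤ , x+h<c+h , c<) = placed e₂ in
  a≤r , r≤ , <-trans (m<m+n x h>0) x+h<c+h , subst (c <_) (+-assoc x h L) c<

heighten-loosely : ∀ {g h L} a x → 0 < L → LooselyPlaced h L (a + L) x g →
  LooselyPlaced (L + h) L a (x + L) (columnSwap L a (x + L) ∪ g)
heighten-loosely {g} {h} {L} a x L>0 placed {r} {c} e with ∪-cases (columnSwap L a (x + L)) g e
... | inj₁ e₁ with columnSwap-column L a (x + L) e₁
...   | refl , a≤r , r≤ = a≤r , ≤-trans r≤ (+-monoʳ-≤ a (m≤m+n L h)) ,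
                         m<m+n (x + L) (<-≤-trans L>0 (m≤m+n L h)) , m<m+n (x + L) L>0
heighten-loosely {g} {h} {L} a x L>0 placed {r} {c} e | inj₂ e₂ =
  let (a+L≤r , r≤ , x<c+h , c<x+L) = placed e₂ in
  m+n≤o⇒m≤o a a+L≤r , subst (r ≤_) (+-assoc a L h) r≤ ,
  subst (x + L <_) (trans (+-assoc c h L) (cong (c +_) (+-comm h L))) (+-monoˡ-< L x<c+h) ,
  <-≤-trans c<x+L (m≤m+n (x + L) L)

widen-tightly : ∀ {g h L} a x → h ≤ L → TightlyPlaced h L a (x + h) g →
  TightlyPlaced h (h + L) a x (columnSwap h a x ∪ g)
widen-tightly {g} {h} {L} a x h≤L placed {r} {c} e with ∪-cases (columnSwap h a x) g e
... | inj₁ e₁ with columnSwap-column h a x e₁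
...   | refl , a≤r , r≤ = a≤r , r≤ , ≤-refl , +-monoʳ-≤ x (≤-trans h≤L (m≤n+m L h))
widen-tightly {g} {h} {L} a x h≤L placed {r} {c} e | inj₂ e₂ =
  let (a≤r , r≤ , x+h≤c , c+h≤) = placed e₂ in
  a≤r , r≤ , ≤-trans (m≤m+n x h) x+h≤c , subst (c + h ≤_) (+-assoc x h L) c+h≤

euclid : ℕ → ℕ → ℕ → ℕ → ℕ → Patch
euclid zero h L a x = empty
euclid (suc f) h L a x with <-cmp h L
... | tri< _ _ _ = columnSwap h a x ∪ euclid f h (L ∸ h) a (x + h)
... | tri≈ _ _ _ = columnSwap h a x
... | tri> _ _ _ = columnSwap L a x ∪ euclid f (h ∸ L) L (a + L) (x ∸ L)

fuel-pred : ∀ {u v f} → 0 < v → u + v ≤ suc f → u ≤ f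
fuel-pred {u} v>0 fuel = ≤-pred (≤-trans (m<m+n u v>0) fuel)

euclid-bridge : ∀ f h L a x → 0 < h → 0 < L → h + L ≤ f → h ≤ suc x →
  Bridge h L a x (euclid f h L a x) × LooselyPlaced h L a x (euclid f h L a x)
euclid-bridge zero (suc _) _ _ _ _ _ () _
euclid-bridge (suc f) h L a x h>0 L>0 fuel room with <-cmp h L
... | tri< h<L _ _ =
  subst (λ L* → Bridge h L* a x g × LooselyPlaced h L* a x g) h+L′≡L
    (bridge-widen a x h>0 L′>0 (proj₁ IH) right , widen-loosely a x h>0 L′>0 (proj₂ IH))
  where
  L′ : ℕ
  L′ = L ∸ h
  g : Patch
  g = columnSwap h a x ∪ euclid f h L′ a (x + h)
  h+L′≡L : h + L′ ≡ L
  h+L′≡L = m+[n∸m]≡n (<⇒≤ h<L)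
  L′>0 : 0 < L′
  L′>0 = m<n⇒0<n∸m h<L
  IH : Bridge h L′ a (x + h) (euclid f h L′ a (x + h)) × LooselyPlaced h L′ a (x + h) (euclid f h L′ a (x + h))
  IH = euclid-bridge f h L′ a (x + h) h>0 L′>0
         (subst (_≤ f) (sym h+L′≡L) (fuel-pred h>0 (subst (_≤ suc f) (+-comm h L) fuel)))
         (≤-trans (m≤n+m h x) (n≤1+n _))
  right : ∀ {r c t} → euclid f h L′ a (x + h) r c ≡ just t → x < c
  right {c = c} e = +-cancelʳ-< h x c (proj₁ (proj₂ (proj₂ (proj₂ IH e))))
... | tri≈ _ refl _ = columnSwap-bridge a x h>0 , columnSwap-loosely a x h>0
... | tri> _ _ L<h =
  subst (λ X → Bridge h L a X (g X) × LooselyPlaced h L a X (g X)) x₂+L≡x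
    (subst (λ H → Bridge H L a (x₂ + L) (g (x₂ + L)) × LooselyPlaced H L a (x₂ + L) (g (x₂ + L))) L+h₁≡h
      (bridge-heighten a x₂ h₁>0 L>0 (proj₁ IH) below , heighten-loosely a x₂ L>0 (proj₂ IH)))
  where
  h₁ x₂ : ℕ
  h₁ = h ∸ L
  x₂ = x ∸ L
  g : ℕ → Patch
  g X = columnSwap L a X ∪ euclid f h₁ L (a + L) x₂
  L+h₁≡h : L + h₁ ≡ h
  L+h₁≡h = m+[n∸m]≡n (<⇒≤ L<h)
  h₁>0 : 0 < h₁
  h₁>0 = m<n⇒0<n∸m L<h
  L≤x : L ≤ x
  L≤x = ≤-pred (≤-trans L<h room)
  x₂+L≡x : x₂ + L ≡ x
  x₂+L≡x = m∸n+n≡m L≤x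
  IH : Bridge h₁ L (a + L) x₂ (euclid f h₁ L (a + L) x₂) × LooselyPlaced h₁ L (a + L) x₂ (euclid f h₁ L (a + L) x₂)
  IH = euclid-bridge f h₁ L (a + L) x₂ h₁>0 L>0
         (subst (_≤ f) (sym (trans (+-comm h₁ L) L+h₁≡h)) (fuel-pred L>0 fuel))
         (subst (h₁ ≤_) (+-∸-assoc 1 L≤x) (∸-monoˡ-≤ L room))
  below : ∀ {r c t} → euclid f h₁ L (a + L) x₂ r c ≡ just t → a + L ≤ r × c < x₂ + L
  below e = let (a+L≤r , _ , _ , c<) = proj₂ IH e in a+L≤r , c<

-- With h = q j + e, the ladder occupies the rungs a, a + j, …, a + q j, a + h
-- of the columns x and x + j.  Going down the rungs cyclically, every cell of
-- column x takes the symbol of the next rung and every cell of column x + j that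
-- of the previous one; the rows a + k j with 0 < k < q are then balanced.
opaque
  ladderˡ : (a x j q e : ℕ) → ℕ → Maybe ℕ
  ladderˡ a x j q e r with r ≟ a + (q * j + e)
  ... | yes _ = just (a + x)
  ... | no _ with r ≟ a + q * j
  ...   | yes _ = just (a + x + (q * j + e))
  ...   | no _ with anyUpTo? (λ k → r ≟ a + k * j) q
  ...     | yes (k , _) = just (a + x + (k * j + j))
  ...     | no _ = nothing

  ladderʳ : (a x j q e : ℕ) → ℕ → Maybe ℕ
  ladderʳ a x j q e r with r ≟ a + (q * j + e)
  ... | yes _ = just (a + x + (j + q * j))
  ... | no _ with r ≟ a
  ...   | yes _ = just (a + x + ((q * j + e) + j))
  ...   | no _ with anyUpTo? (λ k → r ≟ a + (j + k * j)) q
  ...     | yes (k , _) = just (a + x + (j + k * j))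
  ...     | no _ = nothing

  ladder : (a x j q e : ℕ) → Patch
  ladder a x j q e r c with c ≟ x
  ... | yes _ = ladderˡ a x j q e r
  ... | no _ with c ≟ x + j
  ...   | yes _ = ladderʳ a x j q e r
  ...   | no _ = nothing

rung< : ∀ {j k q} → 0 < j → k < q → k * j < q * j
rung< {j} j>0 k<q = *-monoˡ-< j {{>-nonZero j>0}} k<q

rung-injective : ∀ {j k k₁} → 0 < j → k * j ≡ k₁ * j → k ≡ k₁
rung-injective {j} {k} {k₁} j>0 = *-cancelʳ-≡ k k₁ j {{>-nonZero j>0}}

data LeftCell (a x j q e r t : ℕ) : Set where
  foot : r ≡ a + (q * j + e) → t ≡ a + x → LeftCell a x j q e r t
  last : r ≡ a + q * j → t ≡ a + x + (q * j + e) → LeftCell a x j q e r t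
  rung : ∀ k → k < q → r ≡ a + k * j → t ≡ a + x + (k * j + j) → LeftCell a x j q e r t

data RightCell (a x j q e r t : ℕ) : Set where
  foot : r ≡ a + (q * j + e) → t ≡ a + x + (j + q * j) → RightCell a x j q e r t
  head : r ≡ a → t ≡ a + x + ((q * j + e) + j) → RightCell a x j q e r t
  rung : ∀ k → k < q → r ≡ a + (j + k * j) → t ≡ a + x + (j + k * j) → RightCell a x j q e r t

opaque
  unfolding ladder ladderˡ ladderʳ

  ladder-cases : ∀ a x j q e {r c t} → ladder a x j q e r c ≡ just t →
    (c ≡ x × LeftCell a x j q e r t) ⊎ (c ≡ x + j × RightCell a x j q e r t)
  ladder-cases a x j q e {r} {c} {t} eq with c ≟ x
  ... | yes c≡x = inj₁ (c≡x , left eq)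
    where
    left : ladderˡ a x j q e r ≡ just t → LeftCell a x j q e r t
    left eq with r ≟ a + (q * j + e)
    ... | yes p = foot p (sym (just-injective eq))
    ... | no _ with r ≟ a + q * j
    ...   | yes p = last p (sym (just-injective eq))
    ...   | no _ with anyUpTo? (λ k → r ≟ a + k * j) q
    ...     | yes (k , k<q , p) = rung k k<q p (sym (just-injective eq))
    left () | no _ | no _ | no _
  ... | no _ with c ≟ x + j
  ...   | yes c≡x+j = inj₂ (c≡x+j , right eq)
    where
    right : ladderʳ a x j q e r ≡ just t → RightCell a x j q e r t
    right eq with r ≟ a + (q * j + e)
    ... | yes p = foot p (sym (just-injective eq))
    ... | no _ with r ≟ a
    ...   | yes p = head p (sym (just-injective eq))
    ...   | no _ with anyUpTo? (λ k → r ≟ a + (j + k * j)) q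
    ...     | yes (k , k<q , p) = rung k k<q p (sym (just-injective eq))
    right () | no _ | no _ | no _
  ladder-cases a x j q e () | no _ | no _

  ladder-footˡ : ∀ a x j q e → ladder a x j q e (a + (q * j + e)) x ≡ just (a + x)
  ladder-footˡ a x j q e with x ≟ x
  ... | no x≢x = ⊥-elim (x≢x refl)
  ... | yes _ with a + (q * j + e) ≟ a + (q * j + e)
  ...   | yes _ = refl
  ...   | no ≢ = ⊥-elim (≢ refl)

  ladder-lastˡ : ∀ a x j q e → 0 < e → ladder a x j q e (a + q * j) x ≡ just (a + x + (q * j + e))
  ladder-lastˡ a x j q e e>0 with x ≟ x
  ... | no x≢x = ⊥-elim (x≢x refl)
  ... | yes _ with a + q * j ≟ a + (q * j + e)
  ...   | yes p = ⊥-elim (m≢m+n (q * j) e>0 (+-cancelˡ-≡ a _ _ p))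
  ...   | no _ with a + q * j ≟ a + q * j
  ...     | yes _ = refl
  ...     | no ≢ = ⊥-elim (≢ refl)

  ladder-rungˡ : ∀ a x j q e k → 0 < j → k < q → ladder a x j q e (a + k * j) x ≡ just (a + x + (k * j + j))
  ladder-rungˡ a x j q e k j>0 k<q with x ≟ x
  ... | no x≢x = ⊥-elim (x≢x refl)
  ... | yes _ with a + k * j ≟ a + (q * j + e)
  ...   | yes p = ⊥-elim (<⇒≢ (≤-trans (rung< j>0 k<q) (m≤m+n _ e)) (+-cancelˡ-≡ a _ _ p))
  ...   | no _ with a + k * j ≟ a + q * j
  ...     | yes p = ⊥-elim (<⇒≢ (rung< j>0 k<q) (+-cancelˡ-≡ a _ _ p))
  ...     | no _ with anyUpTo? (λ k₁ → a + k * j ≟ a + k₁ * j) q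
  ...       | yes (k₁ , _ , p) = cong (λ u → just (a + x + (u * j + j))) (sym (rung-injective {j} {k} {k₁} j>0 (+-cancelˡ-≡ a _ _ p)))
  ...       | no ∄ = ⊥-elim (∄ (k , k<q , refl))

  ladder-footʳ : ∀ a x j q e → 0 < j → ladder a x j q e (a + (q * j + e)) (x + j) ≡ just (a + x + (j + q * j))
  ladder-footʳ a x j q e j>0 with x + j ≟ x
  ... | yes p = ⊥-elim (m≢m+n x j>0 (sym p))
  ... | no _ with x + j ≟ x + j
  ...   | no ≢ = ⊥-elim (≢ refl)
  ...   | yes _ with a + (q * j + e) ≟ a + (q * j + e)
  ...     | yes _ = refl
  ...     | no ≢ = ⊥-elim (≢ refl)

  ladder-headʳ : ∀ a x j q e → 0 < j → 0 < q * j + e → ladder a x j q e a (x + j) ≡ just (a + x + ((q * j + e) + j))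
  ladder-headʳ a x j q e j>0 h>0 with x + j ≟ x
  ... | yes p = ⊥-elim (m≢m+n x j>0 (sym p))
  ... | no _ with x + j ≟ x + j
  ...   | no ≢ = ⊥-elim (≢ refl)
  ...   | yes _ with a ≟ a + (q * j + e)
  ...     | yes p = ⊥-elim (m≢m+n a h>0 p)
  ...     | no _ with a ≟ a
  ...       | yes _ = refl
  ...       | no ≢ = ⊥-elim (≢ refl)

  ladder-rungʳ : ∀ a x j q e k → 0 < j → 0 < e → k < q →
    ladder a x j q e (a + (j + k * j)) (x + j) ≡ just (a + x + (j + k * j))
  ladder-rungʳ a x j q e k j>0 e>0 k<q with x + j ≟ x
  ... | yes p = ⊥-elim (m≢m+n x j>0 (sym p))
  ... | no _ with x + j ≟ x + j
  ...   | no ≢ = ⊥-elim (≢ refl)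
  ...   | yes _ with a + (j + k * j) ≟ a + (q * j + e)
  ...     | yes p = ⊥-elim (<⇒≢ (<-≤-trans (s≤s (*-monoˡ-≤ j k<q)) (m<m+n (q * j) e>0)) (+-cancelˡ-≡ a _ _ p))
  ...     | no _ with a + (j + k * j) ≟ a
  ...       | yes p = ⊥-elim (m≢m+n a (<-≤-trans j>0 (m≤m+n j (k * j))) (sym p))
  ...       | no _ with anyUpTo? (λ k₁ → a + (j + k * j) ≟ a + (j + k₁ * j)) q
  ...         | yes (k₁ , _ , p) = cong (λ u → just (a + x + (j + u * j)))
                                     (sym (rung-injective {j} {k} {k₁} j>0 (+-cancelˡ-≡ j _ _ (+-cancelˡ-≡ a _ _ p))))
  ...         | no ∄ = ⊥-elim (∄ (k , k<q , refl))

-- Besides the ports of a bridge of height h = q j + e and length h + j, for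
-- e < j the rows a + q j and a + h are unbalanced; a bridge of height e and
-- length j ∸ e repairs them (ladderBridge).
LadderIns : (a x j q e : ℕ) → Port
LadderIns a x j q e r s = Ins (q * j + e) ((q * j + e) + j) a x r s ⊎
  (e < j × ((r ≡ a + q * j × s ≡ a + x + (q * j + j)) ⊎ (r ≡ a + (q * j + e) × s ≡ a + x + (q * j + e))))

LadderOuts : (a x j q e : ℕ) → Port
LadderOuts a x j q e r t = Outs (q * j + e) ((q * j + e) + j) a x r t ⊎
  (e < j × ((r ≡ a + q * j × t ≡ a + x + (q * j + e)) ⊎ (r ≡ a + (q * j + e) × t ≡ a + x + (j + q * j))))

module LadderGadget (a x j q₀ e : ℕ) (j>0 : 0 < j) (e>0 : 0 < e) (e≤j : e ≤ j) where
  q P H : ℕ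
  q = suc q₀
  P = q * j
  H = P + e
  g : Patch
  g = ladder a x j q e
  I O : Port
  I = LadderIns a x j q e
  O = LadderOuts a x j q e
  shift≢ : ∀ {u v} → u ≢ v → a + x + u ≢ a + x + v
  shift≢ u≢v = u≢v ∘ +-cancelˡ-≡ (a + x) _ _
  shift<≢ : ∀ {u v} → u < v → a + x + u ≢ a + x + v
  shift<≢ = shift≢ ∘ <⇒≢
  unshift : ∀ {u v} → a + x + u ≡ a + x + v → u ≡ v
  unshift = +-cancelˡ-≡ (a + x) _ _
  unrow : ∀ {u v} → a + u ≡ a + v → u ≡ v
  unrow = +-cancelˡ-≡ a _ _
  base≢ : ∀ {v} → 0 < v → a + x ≢ a + x + v
  base≢ = m≢m+n (a + x)
  top≢ : ∀ {v} → 0 < v → a ≢ a + v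
  top≢ = m≢m+n a
  sumˡ : ∀ ρ → a + ρ + x ≡ a + x + ρ
  sumˡ ρ = xy∙z≈xz∙y a ρ x
  sumʳ : ∀ ρ → a + ρ + (x + j) ≡ a + x + (ρ + j)
  sumʳ ρ = interchange a ρ x j
  sumʳ₀ : a + (x + j) ≡ a + x + j
  sumʳ₀ = sym (+-assoc a x j)
  same : ∀ {t u v : ℕ} → t ≡ u → t ≡ v → u ≡ v
  same w w′ = trans (sym w) w′
  P<H : P < H
  P<H = m<m+n P e>0
  0<P : 0 < P
  0<P = ≤-trans j>0 (m≤m+n j (q₀ * j))
  0<H : 0 < H
  0<H = ≤-trans 0<P (m≤m+n P e)
  kj+j≤P : ∀ {k} → k < q → k * j + j ≤ P
  kj+j≤P {k} lt = subst (_≤ P) (+-comm j (k * j)) (*-monoˡ-≤ j lt)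
  j+kj≤P : ∀ {k} → k < q → j + k * j ≤ P
  j+kj≤P {k} lt = *-monoˡ-≤ j lt
  kj<P : ∀ {k} → k < q → k * j < P
  kj<P lt = <-≤-trans (m<m+n _ j>0) (kj+j≤P lt)
  next-rung : ∀ {k} → k < q → suc k < q ⊎ k ≡ q₀
  next-rung (s≤s le) with m≤n⇒m<n∨m≡n le
  ... | inj₁ lt = inj₁ (s≤s lt)
  ... | inj₂ eq = inj₂ eq
  e<j⊎e≡j : e < j ⊎ e ≡ j
  e<j⊎e≡j = m≤n⇒m<n∨m≡n e≤j
  footˡ : g (a + H) x ≡ just (a + x)
  footˡ = ladder-footˡ a x j q e
  lastˡ : g (a + P) x ≡ just (a + x + H)
  lastˡ = ladder-lastˡ a x j q e e>0
  rungˡ : ∀ k → k < q → g (a + k * j) x ≡ just (a + x + (k * j + j))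
  rungˡ k lt = ladder-rungˡ a x j q e k j>0 lt
  footʳ : g (a + H) (x + j) ≡ just (a + x + (j + P))
  footʳ = ladder-footʳ a x j q e j>0
  headʳ : g a (x + j) ≡ just (a + x + (H + j))
  headʳ = ladder-headʳ a x j q e j>0 0<H
  rungʳ : ∀ k → k < q → g (a + (j + k * j)) (x + j) ≡ just (a + x + (j + k * j))
  rungʳ k lt = ladder-rungʳ a x j q e k j>0 e>0 lt
  0<q : 0 < q
  0<q = s≤s z≤n
  rungˡ₀ : g a x ≡ just (a + x + (0 + j))
  rungˡ₀ = subst (λ r → g r x ≡ just (a + x + (0 + j))) (+-identityʳ a) (rungˡ 0 0<q)
  cases : ∀ {r c t} → g r c ≡ just t → (c ≡ x × LeftCell a x j q e r t) ⊎ (c ≡ x + j × RightCell a x j q e r t)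
  cases = ladder-cases a x j q e
  leftCell : ∀ {r t} → g r x ≡ just t → LeftCell a x j q e r t
  leftCell eq with cases eq
  ... | inj₁ (_ , cell) = cell
  ... | inj₂ (p , _) = ⊥-elim (m≢m+n x j>0 p)
  rightCell : ∀ {r t} → g r (x + j) ≡ just t → RightCell a x j q e r t
  rightCell eq with cases eq
  ... | inj₁ (p , _) = ⊥-elim (m≢m+n x j>0 (sym p))
  ... | inj₂ (_ , cell) = cell

  moved : ∀ {r c t} → g r c ≡ just t → t ≢ r + c
  moved {r} {c} {t} eq with cases eq
  ... | inj₁ (refl , foot refl refl) = λ w → base≢ 0<H (trans w (sumˡ H))
  ... | inj₁ (refl , last refl refl) = λ w → shift≢ (<⇒≢ P<H ∘ sym) (trans w (sumˡ P))
  ... | inj₁ (refl , rung k lt refl refl) = λ w → shift≢ (λ z → <⇒≢ (m<m+n (k * j) j>0) (sym z)) (trans w (sumˡ (k * j)))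
  ... | inj₂ (refl , foot refl refl) = λ w → shift≢ (λ z → <⇒≢ (+-monoˡ-< j P<H) (trans (+-comm P j) z)) (trans w (sumʳ H))
  ... | inj₂ (refl , head refl refl) = λ w → shift≢ (λ z → <⇒≢ (m<n+m j 0<H) (sym z)) (trans w sumʳ₀)
  ... | inj₂ (refl , rung k lt refl refl) = λ w → shift≢ (λ z → <⇒≢ (m<m+n (j + k * j) j>0) z) (trans w (sumʳ (j + k * j)))

  q₀<q : q₀ < q
  q₀<q = ≤-refl
  col-⊆ : ∀ {r c t} → g r c ≡ just t → ∃ λ r₁ → Occupied g r₁ c × r₁ + c ≡ t
  col-⊆ {r} {c} {t} eq with cases eq
  ... | inj₁ (refl , foot refl refl) = a , (_ , rungˡ₀) , refl
  ... | inj₁ (refl , last refl refl) = a + H , (_ , footˡ) , sumˡ H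
  ... | inj₁ (refl , rung k lt refl refl) with next-rung lt
  ...   | inj₁ slt = a + (j + k * j) , (_ , rungˡ (suc k) slt) , trans (sumˡ (j + k * j)) (cong (a + x +_) (+-comm j (k * j)))
  ...   | inj₂ refl = a + P , (_ , lastˡ) , trans (sumˡ P) (cong (a + x +_) (+-comm j (q₀ * j)))
  col-⊆ {r} {c} {t} eq | inj₂ (refl , foot refl refl) = a + P , (_ , rungʳ q₀ q₀<q) , trans (sumʳ P) (cong (a + x +_) (+-comm P j))
  col-⊆ {r} {c} {t} eq | inj₂ (refl , head refl refl) = a + H , (_ , footʳ) , sumʳ H
  col-⊆ {r} {c} {t} eq | inj₂ (refl , rung zero lt refl refl) = a , (_ , headʳ) , trans sumʳ₀ (cong (a + x +_) (sym (+-identityʳ j)))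
  col-⊆ {r} {c} {t} eq | inj₂ (refl , rung (suc k₁) lt refl refl) =
    a + (j + k₁ * j) , (_ , rungʳ k₁ (<-trans (n<1+n k₁) lt)) , trans (sumʳ _) (cong (a + x +_) (+-comm (j + k₁ * j) j))

  0<kj+j : ∀ k → 0 < k * j + j
  0<kj+j k = ≤-trans j>0 (m≤n+m j (k * j))
  0<j+kj : ∀ k → 0 < j + k * j
  0<j+kj k = ≤-trans j>0 (m≤m+n j (k * j))
  left-inj : ∀ {r r₁ t} → LeftCell a x j q e r t → LeftCell a x j q e r₁ t → r ≡ r₁
  left-inj (foot p w) (foot p′ w′) = trans p (sym p′)
  left-inj (foot p w) (last p′ w′) = ⊥-elim (base≢ 0<H (same w w′))
  left-inj (foot p w) (rung k lt p′ w′) = ⊥-elim (base≢ (0<kj+j k) (same w w′))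
  left-inj (last p w) (foot p′ w′) = ⊥-elim (base≢ 0<H (same w′ w))
  left-inj (last p w) (last p′ w′) = trans p (sym p′)
  left-inj (last p w) (rung k lt p′ w′) = ⊥-elim (shift<≢ (≤-<-trans (kj+j≤P lt) P<H) (sym (same w w′)))
  left-inj (rung k lt p w) (foot p′ w′) = ⊥-elim (base≢ (0<kj+j k) (same w′ w))
  left-inj (rung k lt p w) (last p′ w′) = ⊥-elim (shift<≢ (≤-<-trans (kj+j≤P lt) P<H) (same w w′))
  left-inj (rung k lt p w) (rung k₁ lt₁ p′ w′) =
    trans p (trans (cong (λ u → a + u * j) (rung-injective {j} {k} {k₁} j>0 (+-cancelʳ-≡ j _ _ (unshift (same w w′))))) (sym p′))
  right-inj : ∀ {r r₁ t} → RightCell a x j q e r t → RightCell a x j q e r₁ t → r ≡ r₁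
  right-inj (foot p w) (foot p′ w′) = trans p (sym p′)
  right-inj (foot p w) (head p′ w′) = ⊥-elim (shift<≢ (subst (_< H + j) (+-comm P j) (+-monoˡ-< j P<H)) (same w w′))
  right-inj (foot p w) (rung k lt p′ w′) = ⊥-elim (shift<≢ (+-monoʳ-< j (kj<P lt)) (sym (same w w′)))
  right-inj (head p w) (foot p′ w′) = ⊥-elim (shift<≢ (subst (_< H + j) (+-comm P j) (+-monoˡ-< j P<H)) (same w′ w))
  right-inj (head p w) (head p′ w′) = trans p (sym p′)
  right-inj (head p w) (rung k lt p′ w′) = ⊥-elim (shift<≢ (≤-<-trans (j+kj≤P lt) (<-≤-trans P<H (m≤m+n H j))) (sym (same w w′)))
  right-inj (rung k lt p w) (foot p′ w′) = ⊥-elim (shift<≢ (+-monoʳ-< j (kj<P lt)) (same w w′))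
  right-inj (rung k lt p w) (head p′ w′) = ⊥-elim (shift<≢ (≤-<-trans (j+kj≤P lt) (<-≤-trans P<H (m≤m+n H j))) (same w w′))
  right-inj (rung k lt p w) (rung k₁ lt₁ p′ w′) =
    trans p (trans (cong (λ u → a + (j + u * j)) (rung-injective {j} {k} {k₁} j>0 (+-cancelˡ-≡ j _ _ (unshift (same w w′))))) (sym p′))
  col-inj : ∀ {r r₁ c t} → g r c ≡ just t → g r₁ c ≡ just t → r ≡ r₁
  col-inj e e′ with cases e
  ... | inj₁ (refl , xc) = left-inj xc (leftCell e′)
  ... | inj₂ (refl , yc) = right-inj yc (rightCell e′)

  col-⊇ : ∀ {r c} → Occupied g r c → ∃ λ r₁ → g r₁ c ≡ just (r + c)
  col-⊇ {r} {c} (t , eq) with cases eq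
  ... | inj₁ (refl , foot refl refl) = a + P , trans lastˡ (cong just (sym (sumˡ H)))
  ... | inj₁ (refl , last refl refl) = a + q₀ * j , trans (rungˡ q₀ q₀<q) (cong just (trans (cong (a + x +_) (+-comm (q₀ * j) j)) (sym (sumˡ P))))
  ... | inj₁ (refl , rung zero lt refl refl) = a + H , trans footˡ (cong just (sym (cong (_+ x) (+-identityʳ a))))
  ... | inj₁ (refl , rung (suc k₁) lt refl refl) = a + k₁ * j ,
        trans (rungˡ k₁ (<-trans (n<1+n k₁) lt)) (cong just (trans (cong (a + x +_) (+-comm (k₁ * j) j)) (sym (sumˡ _))))
  ... | inj₂ (refl , foot refl refl) = a , trans headʳ (cong just (sym (sumʳ H)))
  ... | inj₂ (refl , head refl refl) = a + (j + 0) , trans (rungʳ 0 0<q) (cong just (trans (cong (a + x +_) (+-identityʳ j)) (sym sumʳ₀)))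
  ... | inj₂ (refl , rung k lt refl refl) with next-rung lt
  ...   | inj₁ slt = a + (j + (j + k * j)) , trans (rungʳ (suc k) slt) (cong just (trans (cong (a + x +_) (+-comm j (j + k * j))) (sym (sumʳ _))))
  ...   | inj₂ refl = a + H , trans footʳ (cong just (trans (cong (a + x +_) (+-comm j P)) (sym (sumʳ P))))

  outᵃ : O a (a + x + (H + j))
  outᵃ = inj₁ (inj₁ (refl , refl))
  outᴴ : O (a + H) (a + x)
  outᴴ = inj₁ (inj₂ (refl , refl))
  fix-outᴾ : e < j → O (a + P) (a + x + H)
  fix-outᴾ lt = inj₂ (lt , inj₁ (refl , refl))
  fix-outᴴ : e < j → O (a + H) (a + x + (j + P))
  fix-outᴴ lt = inj₂ (lt , inj₂ (refl , refl))
  head-occupied : Occupied g (a + 0) (x + j)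
  head-occupied = subst (λ r → Occupied g r (x + j)) (sym (+-identityʳ a)) (_ , headʳ)
  row-⊆ : ∀ {r c t} → g r c ≡ just t → (∃ λ c₁ → Occupied g r c₁ × r + c₁ ≡ t) ⊎ O r t
  row-⊆ {r} {c} {t} eq with cases eq
  ... | inj₁ (refl , foot refl refl) = inj₂ outᴴ
  ... | inj₁ (refl , last refl refl) with e<j⊎e≡j
  ...   | inj₁ lt = inj₂ (fix-outᴾ lt)
  ...   | inj₂ e≡j = inj₁ (x + j , (_ , rungʳ q₀ q₀<q) , trans (sumʳ P) (cong (λ u → a + x + (P + u)) (sym e≡j)))
  row-⊆ {r} {c} {t} eq | inj₁ (refl , rung zero lt refl refl) = inj₁ (x + j , head-occupied , trans (cong (_+ (x + j)) (+-identityʳ a)) sumʳ₀)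
  row-⊆ {r} {c} {t} eq | inj₁ (refl , rung (suc k₁) lt refl refl) = inj₁ (x + j , (_ , rungʳ k₁ (<-trans (n<1+n k₁) lt)) , sumʳ _)
  row-⊆ {r} {c} {t} eq | inj₂ (refl , foot refl refl) with e<j⊎e≡j
  ...   | inj₁ lt = inj₂ (fix-outᴴ lt)
  ...   | inj₂ e≡j = inj₁ (x , (_ , footˡ) , trans (sumˡ H) (cong (a + x +_) (trans (cong (P +_) e≡j) (+-comm P j))))
  row-⊆ {r} {c} {t} eq | inj₂ (refl , head refl refl) = inj₂ outᵃ
  row-⊆ {r} {c} {t} eq | inj₂ (refl , rung k lt refl refl) with next-rung lt
  ...   | inj₁ slt = inj₁ (x , (_ , rungˡ (suc k) slt) , sumˡ _)
  ...   | inj₂ refl = inj₁ (x , (_ , lastˡ) , sumˡ P)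

  0<jP : 0 < j + P
  0<jP = ≤-trans j>0 (m≤m+n j P)
  left-right-apart : ∀ {r t} → LeftCell a x j q e r t → RightCell a x j q e r t → ⊥
  left-right-apart (foot p w) (foot p′ w′) = base≢ 0<jP (same w w′)
  left-right-apart (foot p w) (head p′ w′) = top≢ 0<H (same p′ p)
  left-right-apart (foot p w) (rung k lt p′ w′) = <⇒≢ (≤-<-trans (j+kj≤P lt) P<H) (unrow (same p′ p))
  left-right-apart (last p w) (foot p′ w′) = <⇒≢ P<H (unrow (same p p′))
  left-right-apart (last p w) (head p′ w′) = top≢ 0<P (same p′ p)
  left-right-apart (last p w) (rung k lt p′ w′) = shift<≢ (≤-<-trans (j+kj≤P lt) P<H) (same w′ w)
  left-right-apart (rung k lt p w) (foot p′ w′) = <⇒≢ (<-trans (kj<P lt) P<H) (unrow (same p p′))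
  left-right-apart (rung k lt p w) (head p′ w′) = shift<≢ (≤-<-trans (kj+j≤P lt) (<-≤-trans P<H (m≤m+n H j))) (same w w′)
  left-right-apart (rung k lt p w) (rung k₁ lt₁ p′ w′) =
    <⇒≢ (m<m+n (j + k₁ * j) j>0) (sym (trans (cong (_+ j) (sym (unrow (same p p′)))) (unshift (same w w′))))
  row-inj : ∀ {r c c₁ t} → g r c ≡ just t → g r c₁ ≡ just t → c ≡ c₁
  row-inj e e′ with cases e | cases e′
  ... | inj₁ (refl , _) | inj₁ (refl , _) = refl
  ... | inj₂ (refl , _) | inj₂ (refl , _) = refl
  ... | inj₁ (refl , xc) | inj₂ (refl , yc) = ⊥-elim (left-right-apart xc yc)
  ... | inj₂ (refl , yc) | inj₁ (refl , xc) = ⊥-elim (left-right-apart xc yc)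

  inᵃ : I a (a + x)
  inᵃ = inj₁ (inj₁ (refl , refl))
  inᴴ : I (a + H) (a + x + (H + j))
  inᴴ = inj₁ (inj₂ (refl , refl))
  fix-inᴾ : e < j → I (a + P) (a + x + (P + j))
  fix-inᴾ lt = inj₂ (lt , inj₁ (refl , refl))
  fix-inᴴ : e < j → I (a + H) (a + x + H)
  fix-inᴴ lt = inj₂ (lt , inj₂ (refl , refl))
  row-⊇ : ∀ {r c} → Occupied g r c → I r (r + c) ⊎ (∃ λ c₁ → g r c₁ ≡ just (r + c))
  row-⊇ {r} {c} (t , eq) with cases eq
  ... | inj₁ (refl , foot refl refl) with e<j⊎e≡j
  ...   | inj₁ lt = inj₁ (subst (I (a + H)) (sym (sumˡ H)) (fix-inᴴ lt))
  ...   | inj₂ e≡j = inj₂ (x + j , trans footʳ (cong just (trans (cong (a + x +_) (trans (+-comm j P) (cong (P +_) (sym e≡j)))) (sym (sumˡ H)))))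
  row-⊇ {r} {c} (t , eq) | inj₁ (refl , last refl refl) = inj₂ (x + j , trans (rungʳ q₀ q₀<q) (cong just (sym (sumˡ P))))
  row-⊇ {r} {c} (t , eq) | inj₁ (refl , rung zero lt refl refl) = inj₁ (subst₂ I (sym (+-identityʳ a)) (sym (cong (_+ x) (+-identityʳ a))) inᵃ)
  row-⊇ {r} {c} (t , eq) | inj₁ (refl , rung (suc k₁) lt refl refl) = inj₂ (x + j , trans (rungʳ k₁ (<-trans (n<1+n k₁) lt)) (cong just (sym (sumˡ _))))
  row-⊇ {r} {c} (t , eq) | inj₂ (refl , foot refl refl) = inj₁ (subst (I (a + H)) (sym (sumʳ H)) inᴴ)
  row-⊇ {r} {c} (t , eq) | inj₂ (refl , head refl refl) = inj₂ (x , trans rungˡ₀ (cong just (sym sumʳ₀)))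
  row-⊇ {r} {c} (t , eq) | inj₂ (refl , rung k lt refl refl) with next-rung lt
  ...   | inj₁ slt = inj₂ (x , trans (rungˡ (suc k) slt) (cong just (sym (sumʳ _))))
  ...   | inj₂ refl with e<j⊎e≡j
  ...     | inj₁ lt₁ = inj₁ (subst (I (a + P)) (sym (sumʳ P)) (fix-inᴾ lt₁))
  ...     | inj₂ e≡j = inj₂ (x , trans lastˡ (cong just (trans (cong (λ u → a + x + (P + u)) e≡j) (sym (sumʳ P)))))

  out-placed : ∀ {r t} → O r t → ∃ λ c → g r c ≡ just t
  out-placed (inj₁ (inj₁ (refl , refl))) = x + j , headʳ
  out-placed (inj₁ (inj₂ (refl , refl))) = x , footˡ
  out-placed (inj₂ (_ , inj₁ (refl , refl))) = x , lastˡ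
  out-placed (inj₂ (_ , inj₂ (refl , refl))) = x + j , footʳ
  in-present : ∀ {r s} → I r s → ∃ λ c → Occupied g r c × r + c ≡ s
  in-present (inj₁ (inj₁ (refl , refl))) = x , (_ , rungˡ₀) , refl
  in-present (inj₁ (inj₂ (refl , refl))) = x + j , (_ , footʳ) , sumʳ H
  in-present (inj₂ (_ , inj₁ (refl , refl))) = x + j , (_ , rungʳ q₀ q₀<q) , sumʳ P
  in-present (inj₂ (_ , inj₂ (refl , refl))) = x , (_ , footˡ) , sumˡ H
  0<Hj : 0 < H + j
  0<Hj = ≤-trans 0<H (m≤m+n H j)
  jP<Hj : j + P < H + j
  jP<Hj = subst (_< H + j) (+-comm P j) (+-monoˡ-< j P<H)
  H<jP : e < j → H < j + P
  H<jP lt = subst (H <_) (+-comm P j) (+-monoʳ-< P lt)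
  in-absent : ∀ {r s c} → I r s → g r c ≡ just s → ⊥
  in-absent (inj₁ (inj₁ (refl , refl))) eq with cases eq
  ... | inj₁ (_ , foot p w) = top≢ 0<H p
  ... | inj₁ (_ , last p w) = base≢ 0<H w
  ... | inj₁ (_ , rung k lt p w) = base≢ (0<kj+j k) w
  ... | inj₂ (_ , foot p w) = top≢ 0<H p
  ... | inj₂ (_ , head p w) = base≢ 0<Hj w
  ... | inj₂ (_ , rung k lt p w) = top≢ (0<j+kj k) p
  in-absent (inj₁ (inj₂ (refl , refl))) eq with cases eq
  ... | inj₁ (_ , foot p w) = base≢ 0<Hj (sym w)
  ... | inj₁ (_ , last p w) = <⇒≢ P<H (sym (unrow p))
  ... | inj₁ (_ , rung k lt p w) = <⇒≢ (<-trans (kj<P lt) P<H) (sym (unrow p))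
  ... | inj₂ (_ , foot p w) = shift<≢ jP<Hj (sym w)
  ... | inj₂ (_ , head p w) = top≢ 0<H (sym p)
  ... | inj₂ (_ , rung k lt p w) = <⇒≢ (≤-<-trans (j+kj≤P lt) P<H) (sym (unrow p))
  in-absent (inj₂ (elt , inj₁ (refl , refl))) eq with cases eq
  ... | inj₁ (_ , foot p w) = <⇒≢ P<H (unrow p)
  ... | inj₁ (_ , last p w) = shift<≢ (+-monoʳ-< P elt) (sym w)
  ... | inj₁ (_ , rung k lt p w) = <⇒≢ (kj<P lt) (sym (unrow p))
  ... | inj₂ (_ , foot p w) = <⇒≢ P<H (unrow p)
  ... | inj₂ (_ , head p w) = top≢ 0<P (sym p)
  ... | inj₂ (_ , rung k lt p w) = shift<≢ (≤-<-trans (j+kj≤P lt) (m<m+n P j>0)) (sym w)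
  in-absent (inj₂ (elt , inj₂ (refl , refl))) eq with cases eq
  ... | inj₁ (_ , foot p w) = base≢ 0<H (sym w)
  ... | inj₁ (_ , last p w) = <⇒≢ P<H (sym (unrow p))
  ... | inj₁ (_ , rung k lt p w) = <⇒≢ (<-trans (kj<P lt) P<H) (sym (unrow p))
  ... | inj₂ (_ , foot p w) = shift<≢ (H<jP elt) w
  ... | inj₂ (_ , head p w) = top≢ 0<H (sym p)
  ... | inj₂ (_ , rung k lt p w) = <⇒≢ (≤-<-trans (j+kj≤P lt) P<H) (sym (unrow p))

ladder-gadget : ∀ a x j q₀ e → 0 < j → 0 < e → e ≤ j →
  Gadget (ladder a x j (suc q₀) e) (LadderIns a x j (suc q₀) e) (LadderOuts a x j (suc q₀) e)
ladder-gadget a x j q₀ e j>0 e>0 e≤j = record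
  { moved = moved ; col-⊆ = col-⊆ ; col-inj = col-inj ; col-⊇ = col-⊇
  ; row-⊆ = row-⊆ ; row-inj = row-inj ; row-⊇ = row-⊇ ; out-placed = out-placed
  ; in-present = in-present ; in-absent = in-absent }
  where open LadderGadget a x j q₀ e j>0 e>0 e≤j

ladder-placed : ∀ a x j q e {r c t} → ladder a x j q e r c ≡ just t →
  (c ≡ x ⊎ c ≡ x + j) × a ≤ r × r ≤ a + (q * j + e)
ladder-placed a x j q e eq with ladder-cases a x j q e eq
... | inj₁ (p , foot refl _) = inj₁ p , m≤m+n a _ , ≤-refl
... | inj₁ (p , last refl _) = inj₁ p , m≤m+n a _ , +-monoʳ-≤ a (m≤m+n _ e)
... | inj₁ (p , rung k k<q refl _) = inj₁ p , m≤m+n a _ , +-monoʳ-≤ a (≤-trans (*-monoˡ-≤ j (<⇒≤ k<q)) (m≤m+n _ e))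
... | inj₂ (p , foot refl _) = inj₂ p , m≤m+n a _ , ≤-refl
... | inj₂ (p , head refl _) = inj₂ p , ≤-refl , m≤m+n a _
... | inj₂ (p , rung k k<q refl _) = inj₂ p , m≤m+n a _ , +-monoʳ-≤ a (≤-trans (*-monoˡ-≤ j k<q) (m≤m+n _ e))

ladder-tight : ∀ a x j q e → TightlyPlaced (q * j + e) ((q * j + e) + j) a x (ladder a x j q e)
ladder-tight a x j q e eq with ladder-placed a x j q e eq
... | inj₁ refl , a≤r , r≤ = a≤r , r≤ , ≤-refl , +-monoʳ-≤ x (m≤m+n _ j)
... | inj₂ refl , a≤r , r≤ = a≤r , r≤ , m≤m+n x j , ≤-reflexive (solve (x ∷ j ∷ q ∷ e ∷ []))

ladderBridge : (a x j q e : ℕ) → Patch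
ladderBridge a x j q e with e <? j
... | yes _ = ladder a x j q e ∪ euclid (suc j) e (j ∸ e) (a + q * j) (x + e)
... | no _ = ladder a x j q e

module LadderRepair (a x j q₀ e : ℕ) (j>0 : 0 < j) (e>0 : 0 < e) (e<j : e < j) where
  P H L′ : ℕ
  P = suc q₀ * j
  H = P + e
  L′ = j ∸ e
  e+L′≡j : e + L′ ≡ j
  e+L′≡j = m+[n∸m]≡n (<⇒≤ e<j)
  repair : Bridge e L′ (a + P) (x + e) (euclid (suc j) e L′ (a + P) (x + e)) ×
           LooselyPlaced e L′ (a + P) (x + e) (euclid (suc j) e L′ (a + P) (x + e))
  repair = euclid-bridge (suc j) e L′ (a + P) (x + e) e>0 (m<n⇒0<n∸m e<j)
             (subst (_≤ suc j) (sym e+L′≡j) (n≤1+n j)) (≤-trans (m≤n+m e x) (n≤1+n _))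
  repair-placed : ∀ {r c t} → euclid (suc j) e L′ (a + P) (x + e) r c ≡ just t → a + P ≤ r × x < c × c < x + j
  repair-placed {r} {c} eq = let (a+P≤r , _ , left , c<) = proj₂ repair eq in
    a+P≤r , +-cancelʳ-< e x c left , subst (c <_) (trans (+-assoc x e L′) (cong (x +_) e+L′≡j)) c<
  apart : Disjoint (ladder a x j (suc q₀) e) (euclid (suc j) e L′ (a + P) (x + e))
  apart (_ , e₁) (_ , e₂) with ladder-placed a x j (suc q₀) e e₁ | repair-placed e₂
  ... | inj₁ refl , _ | _ , x<x , _ = <-irrefl refl x<x
  ... | inj₂ refl , _ | _ , _ , x+j<x+j = <-irrefl refl x+j<x+j
  placed : TightlyPlaced H (H + j) a x (ladder a x j (suc q₀) e ∪ euclid (suc j) e L′ (a + P) (x + e))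
  placed {r} {c} eq with ∪-cases (ladder a x j (suc q₀) e) _ eq
  ... | inj₁ e₁ = ladder-tight a x j (suc q₀) e e₁
  ... | inj₂ e₂ = let (a+P≤r , r≤ , _ , _) = proj₂ repair e₂ ; (_ , x<c , c<x+j) = repair-placed e₂ in
    m+n≤o⇒m≤o a a+P≤r , subst (r ≤_) (+-assoc a P e) r≤ , <⇒≤ x<c ,
    subst (c + H ≤_) (trans (+-assoc x j H) (cong (x +_) (+-comm j H))) (+-monoˡ-≤ H (<⇒≤ c<x+j))
  glue : Glue (ladder a x j (suc q₀) e) (euclid (suc j) e L′ (a + P) (x + e))
              (LadderIns a x j (suc q₀) e) (LadderOuts a x j (suc q₀) e) (Ins e L′ (a + P) (x + e)) (Outs e L′ (a + P) (x + e))
              (Ins H (H + j) a x) (Outs H (H + j) a x)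
  glue = record
    { out₁-glued = λ { (inj₁ o) → inj₂ o
                     ; (inj₂ (_ , inj₁ (refl , refl))) → inj₁ (inj₁ (refl , sym startᴾ))
                     ; (inj₂ (_ , inj₂ (refl , refl))) → inj₁ (inj₂ (sym rowᴴ , endᴴ)) }
    ; out₂-glued = λ { (inj₁ (refl , refl)) → inj₁ (inj₂ (e<j , inj₁ (refl , endᴾ)))
                     ; (inj₂ (refl , refl)) → inj₁ (inj₂ (e<j , inj₂ (rowᴴ , startᴾ))) }
    ; out₁-in₂ = λ { (inj₁ (inj₁ (refl , refl))) (_ , e₂) _ →
                       ⊥-elim (m+1+n≰m a (≤-trans (+-monoʳ-≤ a 0<P) (proj₁ (repair-placed e₂))))
                   ; (inj₁ (inj₂ (refl , refl))) (_ , e₂) q →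
                       ⊥-elim (<⇒≢ (+-mono-≤-< (m≤m+n a H) (proj₁ (proj₂ (repair-placed e₂)))) (sym q))
                   ; (inj₂ (_ , inj₁ (refl , refl))) _ _ → inj₁ (refl , sym startᴾ)
                   ; (inj₂ (_ , inj₂ (refl , refl))) _ _ → inj₂ (sym rowᴴ , endᴴ) }
    ; out₂-in₁ = λ { (inj₁ (refl , refl)) _ _ → inj₂ (e<j , inj₁ (refl , endᴾ))
                   ; (inj₂ (refl , refl)) _ _ → inj₂ (e<j , inj₂ (rowᴴ , startᴾ)) }
    ; outs-apart = λ { (inj₁ (inj₁ (p , _))) (inj₁ (p′ , _)) → top≢ 0<P (trans (sym p) p′)
                     ; (inj₁ (inj₁ (p , _))) (inj₂ (p′ , _)) → top≢ 0<H (trans (sym p) (trans p′ rowᴴ))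
                     ; (inj₁ (inj₂ (p , _))) (inj₁ (p′ , _)) → <⇒≢ P<H (unrow (trans (sym p′) p))
                     ; (inj₁ (inj₂ (refl , refl))) (inj₂ (_ , w)) → base≢ 0<H (trans w startᴾ)
                     ; (inj₂ (_ , inj₁ (refl , refl))) (inj₁ (_ , w)) → shift<≢ H<P+j (trans w endᴾ)
                     ; (inj₂ (_ , inj₁ (p , _))) (inj₂ (p′ , _)) → <⇒≢ P<H (unrow (trans (sym p) (trans p′ rowᴴ)))
                     ; (inj₂ (_ , inj₂ (p , _))) (inj₁ (p′ , _)) → <⇒≢ P<H (unrow (trans (sym p′) p))
                     ; (inj₂ (_ , inj₂ (refl , refl))) (inj₂ (_ , w)) → shift<≢ H<j+P (sym (trans w startᴾ)) }
    ; in₁-glued = λ { (inj₁ i) → inj₁ i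
                    ; (inj₂ (_ , inj₁ (refl , refl))) → inj₂ (inj₁ (refl , sym endᴾ))
                    ; (inj₂ (_ , inj₂ (refl , refl))) → inj₂ (inj₂ (sym rowᴴ , sym startᴾ)) }
    ; in₂-glued = λ { (inj₁ (refl , refl)) → inj₂ (inj₂ (e<j , inj₁ (refl , startᴾ)))
                    ; (inj₂ (refl , refl)) → inj₂ (inj₂ (e<j , inj₂ (rowᴴ , trans endᴾ (cong (a + x +_) (+-comm P j))))) }
    ; out-split = inj₁ ∘ inj₁
    ; in-split = inj₁ ∘ inj₁
    ; out₁-not-in = λ { (inj₁ o) i → bridge-apart o i
                      ; (inj₂ (_ , inj₁ (p , _))) (inj₁ (p′ , _)) → top≢ 0<P (trans (sym p′) p)
                      ; (inj₂ (_ , inj₁ (p , _))) (inj₂ (p′ , _)) → <⇒≢ P<H (unrow (trans (sym p) p′))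
                      ; (inj₂ (_ , inj₂ (p , _))) (inj₁ (p′ , _)) → top≢ 0<H (trans (sym p′) p)
                      ; (inj₂ (_ , inj₂ (refl , refl))) (inj₂ (_ , w)) → shift<≢ j+P<H+j w }
    ; out₂-not-in = λ { (inj₁ (p , _)) (inj₁ (p′ , _)) → top≢ 0<P (trans (sym p′) p)
                      ; (inj₁ (p , _)) (inj₂ (p′ , _)) → <⇒≢ P<H (unrow (trans (sym p) p′))
                      ; (inj₂ (p , _)) (inj₁ (p′ , _)) → top≢ 0<H (trans (sym p′) (trans p rowᴴ))
                      ; (inj₂ (refl , refl)) (inj₂ (_ , w)) → m≢m+n (a + x + H) j>0 (trans (sym startᴾ) (trans w (sym (+-assoc (a + x) H j)))) }
    }
    where
    startᴾ : a + P + (x + e) ≡ a + x + H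
    startᴾ = interchange a P x e
    endᴾ : a + P + (x + e) + L′ ≡ a + x + (P + j)
    endᴾ = begin
      a + P + (x + e) + L′  ≡⟨ cong (_+ L′) startᴾ ⟩
      a + x + (P + e) + L′  ≡⟨ +-assoc (a + x) (P + e) L′ ⟩
      a + x + (P + e + L′)  ≡⟨ cong (a + x +_) (+-assoc P e L′) ⟩
      a + x + (P + (e + L′)) ≡⟨ cong (λ u → a + x + (P + u)) e+L′≡j ⟩
      a + x + (P + j)       ∎
      where open ≡-Reasoning
    endᴴ : a + x + (j + P) ≡ a + P + (x + e) + L′
    endᴴ = trans (cong (a + x +_) (+-comm j P)) (sym endᴾ)
    rowᴴ : a + P + e ≡ a + H
    rowᴴ = +-assoc a P e
    0<P : 0 < P
    0<P = <-≤-trans j>0 (m≤m+n j (q₀ * j))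
    0<H : 0 < H
    0<H = <-≤-trans 0<P (m≤m+n P e)
    P<H : P < H
    P<H = m<m+n P e>0
    H<P+j : H < P + j
    H<P+j = +-monoʳ-< P e<j
    H<j+P : H < j + P
    H<j+P = subst (H <_) (+-comm P j) H<P+j
    j+P<H+j : j + P < H + j
    j+P<H+j = subst (_< H + j) (+-comm P j) (+-monoˡ-< j P<H)
    top≢ : ∀ {v} → 0 < v → a ≢ a + v
    top≢ = m≢m+n a
    base≢ : ∀ {v} → 0 < v → a + x ≢ a + x + v
    base≢ = m≢m+n (a + x)
    shift<≢ : ∀ {u v} → u < v → a + x + u ≢ a + x + v
    shift<≢ u<v = <⇒≢ u<v ∘ +-cancelˡ-≡ (a + x) _ _
    unrow : ∀ {u v} → a + u ≡ a + v → u ≡ v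
    unrow = +-cancelˡ-≡ a _ _
    bridge-apart : ∀ {r s} → Outs H (H + j) a x r s → Ins H (H + j) a x r s → ⊥
    bridge-apart (inj₁ (refl , refl)) (inj₁ (_ , w)) = base≢ (<-≤-trans 0<H (m≤m+n H j)) (sym w)
    bridge-apart (inj₁ (p , _)) (inj₂ (p′ , _)) = top≢ 0<H (trans (sym p) p′)
    bridge-apart (inj₂ (p , _)) (inj₁ (p′ , _)) = top≢ 0<H (trans (sym p′) p)
    bridge-apart (inj₂ (refl , refl)) (inj₂ (_ , w)) = base≢ (<-≤-trans 0<H (m≤m+n H j)) w

ladderBridge-bridge : ∀ a x j q e → 0 < q → 0 < j → 0 < e → e ≤ j →
  let H = q * j + e in
  Bridge H (H + j) a x (ladderBridge a x j q e) × TightlyPlaced H (H + j) a x (ladderBridge a x j q e)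
ladderBridge-bridge a x j (suc q₀) e _ j>0 e>0 e≤j with e <? j
... | no e≮j = gadget-resp (ladder-gadget a x j q₀ e j>0 e>0 e≤j) ins inj₁ outs inj₁ , ladder-tight a x j (suc q₀) e
  where
  ins : ∀ {r s} → LadderIns a x j (suc q₀) e r s → Ins (suc q₀ * j + e) (suc q₀ * j + e + j) a x r s
  ins (inj₁ i) = i
  ins (inj₂ (e<j , _)) = ⊥-elim (e≮j e<j)
  outs : ∀ {r s} → LadderOuts a x j (suc q₀) e r s → Outs (suc q₀ * j + e) (suc q₀ * j + e + j) a x r s
  outs (inj₁ o) = o
  outs (inj₂ (e<j , _)) = ⊥-elim (e≮j e<j)
... | yes e<j = ∪-gadget (ladder-gadget a x j q₀ e j>0 e>0 e≤j) (proj₁ repair) apart glue , placed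
  where open LadderRepair a x j q₀ e j>0 e>0 e<j

-- h = q j + e with q = (h - 1) / j and e = (h - 1) % j + 1, so that 1 ≤ e ≤ j.
shortBridge : ℕ → ℕ → ℕ → ℕ → Patch
shortBridge h zero a x = empty
shortBridge h j@(suc _) a x = ladderBridge a x j ((h ∸ 1) / j) (suc ((h ∸ 1) % j))

shortBridge-bridge : ∀ h j a x → 0 < j → j < h →
  Bridge h (h + j) a x (shortBridge h j a x) × TightlyPlaced h (h + j) a x (shortBridge h j a x)
shortBridge-bridge (suc h₀) j@(suc _) a x _ (s≤s j≤h₀) =
  subst (λ H → Bridge H (H + j) a x g × TightlyPlaced H (H + j) a x g) q*j+e≡h
    (ladderBridge-bridge a x j q e (m≥n⇒m/n>0 j≤h₀) (s≤s z≤n) (s≤s z≤n) (m%n<n h₀ j))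
  where
  q e : ℕ
  q = h₀ / j
  e = suc (h₀ % j)
  g : Patch
  g = ladderBridge a x j q e
  q*j+e≡h : q * j + e ≡ suc h₀
  q*j+e≡h = trans (+-suc (q * j) (h₀ % j)) (cong suc (trans (+-comm (q * j) _) (sym (m≡m%n+[m/n]*n h₀ j))))

-- Unlike euclid, whose cells spread over the columns x - h < c < x + L, this
-- keeps them in x ≤ c ≤ x + L - h: column swaps while L ≥ 2h, then a short bridge.
tightBridge : ℕ → ℕ → ℕ → ℕ → ℕ → Patch
tightBridge zero h L a x = empty
tightBridge (suc f) h L a x with L ≟ h
... | yes _ = columnSwap h a x
... | no _ with h + h ≤? L
...   | yes _ = columnSwap h a x ∪ tightBridge f h (L ∸ h) a (x + h)
...   | no _ = shortBridge h (L ∸ h) a x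

tightBridge-bridge : ∀ f h L a x → 0 < h → h ≤ L → L ≤ f →
  Bridge h L a x (tightBridge f h L a x) × TightlyPlaced h L a x (tightBridge f h L a x)
tightBridge-bridge zero (suc _) L a x _ h≤L L≤0 = ⊥-elim (m+1+n≰m 0 (≤-trans h≤L L≤0))
tightBridge-bridge (suc f) h L a x h>0 h≤L L≤f with L ≟ h
... | yes refl = columnSwap-bridge a x h>0 , columnSwap-tightly a x
... | no L≢h with h + h ≤? L
...   | yes 2h≤L =
  subst (λ L* → Bridge h L* a x g × TightlyPlaced h L* a x g) h+L′≡L
    (bridge-widen a x h>0 L′>0 (proj₁ IH) right , widen-tightly a x h≤L′ (proj₂ IH))
  where
  L′ : ℕ
  L′ = L ∸ h
  g : Patch
  g = columnSwap h a x ∪ tightBridge f h L′ a (x + h)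
  h+L′≡L : h + L′ ≡ L
  h+L′≡L = m+[n∸m]≡n h≤L
  h≤L′ : h ≤ L′
  h≤L′ = m+n≤o⇒m≤o∸n h 2h≤L
  L′>0 : 0 < L′
  L′>0 = <-≤-trans h>0 h≤L′
  IH : Bridge h L′ a (x + h) (tightBridge f h L′ a (x + h)) × TightlyPlaced h L′ a (x + h) (tightBridge f h L′ a (x + h))
  IH = tightBridge-bridge f h L′ a (x + h) h>0 h≤L′ (≤-trans (∸-monoʳ-≤ L h>0) (∸-monoˡ-≤ 1 L≤f))
  right : ∀ {r c t} → tightBridge f h L′ a (x + h) r c ≡ just t → x < c
  right e = <-≤-trans (m<m+n x h>0) (proj₁ (proj₂ (proj₂ (proj₂ IH e))))
...   | no 2h≰L = subst (λ L* → Bridge h L* a x g × TightlyPlaced h L* a x g) h+j≡L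
                    (shortBridge-bridge h j a x j>0 j<h)
  where
  j : ℕ
  j = L ∸ h
  g : Patch
  g = shortBridge h j a x
  h+j≡L : h + j ≡ L
  h+j≡L = m+[n∸m]≡n h≤L
  j>0 : 0 < j
  j>0 = m<n⇒0<n∸m (≤∧≢⇒< h≤L (L≢h ∘ sym))
  j<h : j < h
  j<h = +-cancelˡ-< h j h (subst (_< h + h) (sym h+j≡L) (≰⇒> 2h≰L))

tradePatch : ℕ → ℕ → Patch
tradePatch m n = columnSwap m 0 0 ∪ (columnSwap m 0 m ∪ tightBridge n m (n ∸ (m + m)) 0 (m + m))

Corner : ℕ → ℕ → ℕ → Set
Corner m r c = (r ≡ 0 ⊎ r ≡ m) × (c ≡ 0 ⊎ c ≡ m)

module _ {m n : ℕ} (m>0 : 0 < m) (3m≤n : 3 * m ≤ n) where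
  private
    L : ℕ
    L = n ∸ (m + m)
    2m+L≡n : m + m + L ≡ n
    2m+L≡n = m+[n∸m]≡n (≤-trans (+-monoʳ-≤ m (m≤m+n m (m + 0))) 3m≤n)
    m≤L : m ≤ L
    m≤L = m+n≤o⇒m≤o∸n m (subst (_≤ n) (cong (m +_) (cong (m +_) (+-identityʳ m))) 3m≤n)
    tight : Bridge m L 0 (m + m) (tightBridge n m L 0 (m + m)) × TightlyPlaced m L 0 (m + m) (tightBridge n m L 0 (m + m))
    tight = tightBridge-bridge n m L 0 (m + m) m>0 m≤L (m∸n≤m n (m + m))

  tradePatch-bridge : Bridge m n 0 0 (tradePatch m n)
  tradePatch-bridge =
    subst (λ N → Bridge m N 0 0 (tradePatch m n)) (trans (sym (+-assoc m m L)) 2m+L≡n)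
      (bridge-widen 0 0 m>0 (<-≤-trans m>0 (m≤m+n m L)) inner inner-right)
    where
    inner : Bridge m (m + L) 0 m (columnSwap m 0 m ∪ tightBridge n m L 0 (m + m))
    inner = bridge-widen 0 m m>0 (<-≤-trans m>0 m≤L) (proj₁ tight)
              (λ e → <-≤-trans (m<m+n m m>0) (proj₁ (proj₂ (proj₂ (proj₂ tight e)))))
    inner-right : ∀ {r c t} → (columnSwap m 0 m ∪ tightBridge n m L 0 (m + m)) r c ≡ just t → 0 < c
    inner-right e with ∪-cases (columnSwap m 0 m) _ e
    ... | inj₁ e₁ = subst (0 <_) (sym (proj₁ (columnSwap-column m 0 m e₁))) m>0
    ... | inj₂ e₂ = <-≤-trans m>0 (≤-trans (m≤m+n m m) (proj₁ (proj₂ (proj₂ (proj₂ tight e₂)))))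

  private
    corner : ∀ {x r c t} → (x ≡ 0 ⊎ x ≡ m) → columnSwap m 0 x r c ≡ just t →
      r ≤ m × (Corner m r c ⊎ (m + m ≤ c × c + m ≤ n))
    corner x∈ e with columnSwap-cases m 0 _ e
    ... | refl , inj₁ (refl , _) = z≤n , inj₁ (inj₁ refl , x∈)
    ... | refl , inj₂ (refl , _) = ≤-refl , inj₁ (inj₂ refl , x∈)

  tradePatch-placed : ∀ {r c t} → tradePatch m n r c ≡ just t → r ≤ m × (Corner m r c ⊎ (m + m ≤ c × c + m ≤ n))
  tradePatch-placed e with ∪-cases (columnSwap m 0 0) _ e
  ... | inj₁ e₁ = corner (inj₁ refl) e₁
  ... | inj₂ e₂ with ∪-cases (columnSwap m 0 m) _ e₂
  ...   | inj₁ e₃ = corner (inj₂ refl) e₃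
  ...   | inj₂ e₄ = let (_ , r≤m , 2m≤c , c+m≤) = proj₂ tight e₄ in r≤m , inj₂ (2m≤c , subst (_ + m ≤_) 2m+L≡n c+m≤)

mod≡⇒%≡ : ∀ {n x y} .{{_ : NonZero n}} → x mod n ≡ y mod n → x % n ≡ y % n
mod≡⇒%≡ eq = trans (sym (toℕ-fromℕ< _)) (trans (cong toℕ eq) (toℕ-fromℕ< _))

0%n≡0 : ∀ n .{{_ : NonZero n}} → 0 % n ≡ 0
0%n≡0 (suc _) = refl

mod-≤-cases : ∀ {n x y} .{{_ : NonZero n}} → x ≤ n → y ≤ n → x mod n ≡ y mod n →
  x ≡ y ⊎ (x ≡ 0 × y ≡ n) ⊎ (x ≡ n × y ≡ 0)
mod-≤-cases {n} x≤n y≤n eq with m≤n⇒m<n∨m≡n x≤n | m≤n⇒m<n∨m≡n y≤n | mod≡⇒%≡ eq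
... | inj₁ x<n | inj₁ y<n | x%≡y% = inj₁ (trans (sym (m<n⇒m%n≡m x<n)) (trans x%≡y% (m<n⇒m%n≡m y<n)))
... | inj₁ x<n | inj₂ refl | x%≡y% = inj₂ (inj₁ (trans (sym (m<n⇒m%n≡m x<n)) (trans x%≡y% (n%n≡0 n)) , refl))
... | inj₂ refl | inj₁ y<n | x%≡y% = inj₂ (inj₂ (refl , trans (sym (m<n⇒m%n≡m y<n)) (trans (sym x%≡y%) (n%n≡0 n))))
... | inj₂ refl | inj₂ refl | _ = inj₁ refl

0-mod≡n-mod : ∀ n .{{_ : NonZero n}} → 0 mod n ≡ n mod n
0-mod≡n-mod n = toℕ-injective (trans (toℕ-fromℕ< _) (trans (0%n≡0 n) (trans (sym (n%n≡0 n)) (sym (toℕ-fromℕ< _)))))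

-- A bridge of length n from row 0 to row m lying in the triangle r + c ≤ n and
-- touching its hypotenuse only in row m closes up, modulo n, to a Latin trade:
-- T keeps the symbols (r + c) mod n of the occupied cells, its mate takes g's.
module Closing {m n₀ : ℕ} {g : Patch} (G : Bridge m (suc n₀) 0 0 g) (m>0 : 0 < m)
  (inside : ∀ {r c} → Occupied g r c → r < suc n₀ × c < suc n₀ × r + c ≤ suc n₀)
  (rim : ∀ {r c} → Occupied g r c → r + c ≡ suc n₀ → r ≡ m)
  where
  open Gadget G

  private
    n : ℕ
    n = suc n₀

  T : Array n
  T r c with g (toℕ r) (toℕ c)
  ... | just _ = just ((toℕ r + toℕ c) mod n)
  ... | nothing = nothing

  T′ : Array n
  T′ r c with g (toℕ r) (toℕ c)
  ... | just t = just (t mod n)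
  ... | nothing = nothing

  T-cases : ∀ {r c s} → T r c ≡ just s → Occupied g (toℕ r) (toℕ c) × s ≡ (toℕ r + toℕ c) mod n
  T-cases {r} {c} eq with g (toℕ r) (toℕ c)
  ... | just t = (t , refl) , sym (just-injective eq)

  T-intro : ∀ {r c} → Occupied g (toℕ r) (toℕ c) → T r c ≡ just ((toℕ r + toℕ c) mod n)
  T-intro {r} {c} (t , eq) with g (toℕ r) (toℕ c)
  ... | just _ = refl

  T′-cases : ∀ {r c s} → T′ r c ≡ just s → ∃ λ t → g (toℕ r) (toℕ c) ≡ just t × s ≡ t mod n
  T′-cases {r} {c} eq with g (toℕ r) (toℕ c)
  ... | just t = t , refl , sym (just-injective eq)

  T′-intro : ∀ {r c t} → g (toℕ r) (toℕ c) ≡ just t → T′ r c ≡ just (t mod n)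
  T′-intro {r} {c} eq with g (toℕ r) (toℕ c)
  ... | just _ = cong (λ u → just (u mod n)) (just-injective eq)

  private
    row<n : ∀ {r c} → Occupied g r c → r < n
    row<n = proj₁ ∘ inside
    col<n : ∀ {r c} → Occupied g r c → c < n
    col<n = proj₁ ∘ proj₂ ∘ inside
    sum≤n : ∀ {r c} → Occupied g r c → r + c ≤ n
    sum≤n = proj₂ ∘ proj₂ ∘ inside
    new≤n : ∀ {r c t} → g r c ≡ just t → t ≤ n
    new≤n e = let (_ , o , q) = col-⊆ e in subst (_≤ n) q (sum≤n o)
    m≢0 : m ≢ 0
    m≢0 = <⇒≢ m>0 ∘ sym
    on-col0 : ∀ {r c} → Occupied g r c → c ≡ 0 → r + c ≢ n
    on-col0 {r} o refl q = <⇒≢ (row<n o) (trans (sym (+-identityʳ r)) q)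

    -- the symbols 0 and n of the mate come from the ports of rows m and 0
    new0-row : ∀ {r c} → g r c ≡ just 0 → r ≡ m
    new0-row {r} e with row-⊆ e
    ... | inj₁ (_ , _ , q) = ⊥-elim (in-absent (inj₁ (m+n≡0⇒m≡0 r q , refl)) e)
    ... | inj₂ (inj₁ (_ , ()))
    ... | inj₂ (inj₂ (p , _)) = p
    newn-row : ∀ {r c} → g r c ≡ just n → r ≡ 0
    newn-row e with row-⊆ e
    ... | inj₁ (_ , o , q) = ⊥-elim (in-absent (inj₂ (rim o q , refl)) e)
    ... | inj₂ (inj₁ (p , _)) = p
    ... | inj₂ (inj₂ (_ , ()))
    new0-col : ∀ {r c} → g r c ≡ just 0 → c ≡ 0
    new0-col e = let (r₁ , _ , q) = col-⊆ e in m+n≡0⇒n≡0 r₁ q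
    newn-col : ∀ {r c} → g r c ≡ just n → c ≢ 0
    newn-col e c≡0 = let (_ , o , q) = col-⊆ e in on-col0 o c≡0 q

    fin : ∀ {k} → k < n → Fin n
    fin k<n = fromℕ< k<n
    toℕ-fin : ∀ {k} (k<n : k < n) → toℕ (fin k<n) ≡ k
    toℕ-fin k<n = toℕ-fromℕ< k<n
    col-fin : ∀ {r c} → Occupied g r c → ∃ λ (fc : Fin n) → Occupied g r (toℕ fc) × toℕ fc ≡ c
    col-fin {r} o = fin (col<n o) , subst (Occupied g r) (sym (toℕ-fin (col<n o))) o , toℕ-fin (col<n o)
    row-fin : ∀ {r c} → Occupied g r c → ∃ λ (fr : Fin n) → Occupied g (toℕ fr) c × toℕ fr ≡ r
    row-fin {c = c} o = fin (row<n o) , subst (λ u → Occupied g u c) (sym (toℕ-fin (row<n o))) o , toℕ-fin (row<n o)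
    new-col-fin : ∀ {r c t} → g r c ≡ just t → ∃ λ (fc : Fin n) → g r (toℕ fc) ≡ just t
    new-col-fin {r} e = fin (col<n (_ , e)) , subst (λ u → g r u ≡ just _) (sym (toℕ-fin (col<n (_ , e)))) e
    new-row-fin : ∀ {r c t} → g r c ≡ just t → ∃ λ (fr : Fin n) → g (toℕ fr) c ≡ just t
    new-row-fin {c = c} e = fin (row<n (_ , e)) , subst (λ u → g u c ≡ just _) (sym (toℕ-fin (row<n (_ , e)))) e

  T-rows : ∀ (r c c₁ s : Fin n) → T r c ≡ just s → T r c₁ ≡ just s → c ≡ c₁
  T-rows r c c₁ s e₁ e₂ with T-cases e₁ | T-cases e₂
  ... | o₁ , s₁ | o₂ , s₂ with mod-≤-cases (sum≤n o₁) (sum≤n o₂) (trans (sym s₁) s₂)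
  ...   | inj₁ q = toℕ-injective (+-cancelˡ-≡ _ _ _ q)
  ...   | inj₂ (inj₁ (z , w)) = ⊥-elim (m≢0 (trans (sym (rim o₂ w)) (m+n≡0⇒m≡0 _ z)))
  ...   | inj₂ (inj₂ (w , z)) = ⊥-elim (m≢0 (trans (sym (rim o₁ w)) (m+n≡0⇒m≡0 _ z)))

  T-cols : ∀ (r r₁ c s : Fin n) → T r c ≡ just s → T r₁ c ≡ just s → r ≡ r₁
  T-cols r r₁ c s e₁ e₂ with T-cases e₁ | T-cases e₂
  ... | o₁ , s₁ | o₂ , s₂ with mod-≤-cases (sum≤n o₁) (sum≤n o₂) (trans (sym s₁) s₂)
  ...   | inj₁ q = toℕ-injective (+-cancelʳ-≡ _ _ _ q)
  ...   | inj₂ (inj₁ (z , w)) = ⊥-elim (on-col0 o₂ (m+n≡0⇒n≡0 (toℕ r) z) w)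
  ...   | inj₂ (inj₂ (w , z)) = ⊥-elim (on-col0 o₁ (m+n≡0⇒n≡0 (toℕ r₁) z) w)

  T⊆B : SubB T
  T⊆B r c s e = trans (cong toℕ (proj₂ (T-cases {r} {c} e))) (toℕ-fromℕ< _)

  T′-rows : ∀ (r c c₁ s : Fin n) → T′ r c ≡ just s → T′ r c₁ ≡ just s → c ≡ c₁
  T′-rows r c c₁ s e₁ e₂ with T′-cases e₁ | T′-cases e₂
  ... | t , f₁ , s₁ | t₁ , f₂ , s₂ with mod-≤-cases (new≤n f₁) (new≤n f₂) (trans (sym s₁) s₂)
  ...   | inj₁ refl = toℕ-injective (row-inj f₁ f₂)
  ...   | inj₂ (inj₁ (refl , refl)) = ⊥-elim (m≢0 (trans (sym (new0-row f₁)) (newn-row f₂)))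
  ...   | inj₂ (inj₂ (refl , refl)) = ⊥-elim (m≢0 (trans (sym (new0-row f₂)) (newn-row f₁)))

  T′-cols : ∀ (r r₁ c s : Fin n) → T′ r c ≡ just s → T′ r₁ c ≡ just s → r ≡ r₁
  T′-cols r r₁ c s e₁ e₂ with T′-cases e₁ | T′-cases e₂
  ... | t , f₁ , s₁ | t₁ , f₂ , s₂ with mod-≤-cases (new≤n f₁) (new≤n f₂) (trans (sym s₁) s₂)
  ...   | inj₁ refl = toℕ-injective (col-inj f₁ f₂)
  ...   | inj₂ (inj₁ (refl , refl)) = ⊥-elim (newn-col f₂ (new0-col f₁))
  ...   | inj₂ (inj₂ (refl , refl)) = ⊥-elim (newn-col f₁ (new0-col f₂))

  T∩T′≡∅ : ∀ (r c s : Fin n) → T r c ≡ just s → T′ r c ≡ just s → ⊥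
  T∩T′≡∅ r c s e₁ e₂ with T-cases e₁ | T′-cases e₂
  ... | o , s₁ | t , f , s₂ with mod-≤-cases (sum≤n o) (new≤n f) (trans (sym s₁) s₂)
  ...   | inj₁ q = moved f (sym q)
  ...   | inj₂ (inj₁ (z , refl)) = newn-col f (m+n≡0⇒n≡0 (toℕ r) z)
  ...   | inj₂ (inj₂ (w , refl)) = on-col0 o (new0-col f) w

  same-cells : ∀ (r c : Fin n) → Filled T r c ⇔ Filled T′ r c
  same-cells r c = mk⇔ (λ (_ , e) → let ((_ , f) , _) = T-cases {r} {c} e in _ , T′-intro {r} {c} f)
                       (λ (_ , e) → let (_ , f , _) = T′-cases {r} {c} e in _ , T-intro {r} {c} (_ , f))

  private
    T-at : ∀ {r c u} (fc : Fin n) → Occupied g (toℕ r) (toℕ fc) → toℕ fc ≡ c → toℕ r + c ≡ u →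
           T r fc ≡ just (u mod n)
    T-at {r} fc o refl refl = T-intro {r} {fc} o
    T-at′ : ∀ {r c u} (fr : Fin n) → Occupied g (toℕ fr) (toℕ c) → toℕ fr ≡ r → r + toℕ c ≡ u →
            T fr c ≡ just (u mod n)
    T-at′ {c = c} fr o refl refl = T-intro {fr} {c} o

  same-row-symbols : ∀ (r s : Fin n) → (∃ λ c → T r c ≡ just s) ⇔ (∃ λ c → T′ r c ≡ just s)
  same-row-symbols r s = mk⇔ to from
    where
    to : (∃ λ c → T r c ≡ just s) → ∃ λ c → T′ r c ≡ just s
    to (c , e) with T-cases {r} {c} e
    ... | o , refl with row-⊇ o
    ...   | inj₂ (_ , f) = let (fc , f′) = new-col-fin f in fc , T′-intro {r} {fc} f′
    ...   | inj₁ (inj₁ (r≡0 , q)) = let (fc , f′) = new-col-fin (proj₂ (out-placed (inj₁ (r≡0 , refl)))) in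
            fc , trans (T′-intro {r} {fc} f′) (cong just (trans (sym (0-mod≡n-mod n)) (cong (_mod n) (sym q))))
    ...   | inj₁ (inj₂ (r≡m , q)) = let (fc , f′) = new-col-fin (proj₂ (out-placed (inj₂ (r≡m , refl)))) in
            fc , trans (T′-intro {r} {fc} f′) (cong just (trans (0-mod≡n-mod n) (cong (_mod n) (sym q))))
    from : (∃ λ c → T′ r c ≡ just s) → ∃ λ c → T r c ≡ just s
    from (c , e) with T′-cases {r} {c} e
    ... | t , f , refl with row-⊆ f
    ...   | inj₁ (_ , o , q) = let (fc , o′ , w) = col-fin o in fc , T-at fc o′ w q
    ...   | inj₂ (inj₁ (r≡0 , refl)) = let (_ , o , q) = in-present (inj₁ (r≡0 , refl)) ; (fc , o′ , w) = col-fin o in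
            fc , trans (T-at fc o′ w q) (cong just (0-mod≡n-mod n))
    ...   | inj₂ (inj₂ (r≡m , refl)) = let (_ , o , q) = in-present (inj₂ (r≡m , refl)) ; (fc , o′ , w) = col-fin o in
            fc , trans (T-at fc o′ w q) (cong just (sym (0-mod≡n-mod n)))

  same-col-symbols : ∀ (c s : Fin n) → (∃ λ r → T r c ≡ just s) ⇔ (∃ λ r → T′ r c ≡ just s)
  same-col-symbols c s = mk⇔ to from
    where
    to : (∃ λ r → T r c ≡ just s) → ∃ λ r → T′ r c ≡ just s
    to (r , e) with T-cases {r} {c} e
    ... | o , refl = let (fr , f) = new-row-fin (proj₂ (col-⊇ o)) in fr , T′-intro {fr} {c} f
    from : (∃ λ r → T′ r c ≡ just s) → ∃ λ r → T r c ≡ just s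
    from (r , e) with T′-cases {r} {c} e
    ... | t , f , refl = let (_ , o , q) = col-⊆ f ; (fr , o′ , w) = row-fin o in fr , T-at′ fr o′ w q

  T-trade : NonEmpty T → IsLatinTradeInB T
  T-trade nonEmpty =
    nonEmpty , (T-rows , T-cols) , T⊆B ,
    T′ , (T′-rows , T′-cols) , T∩T′≡∅ , same-cells , same-row-symbols , same-col-symbols

  T-symbol : ∀ {r c s} → T r c ≡ just s → toℕ r + toℕ c < n → toℕ s ≡ toℕ r + toℕ c
  T-symbol {r} {c} e r+c<n = trans (cong toℕ (proj₂ (T-cases {r} {c} e))) (trans (toℕ-fromℕ< _) (m<n⇒m%n≡m r+c<n))

  T-entry : ∀ {r c} → r + c < n → Occupied g r c → HasEntry T r c (r + c)
  T-entry {r} {c} r+c<n o =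
    fr , fc , _ , toℕ-fin r<n , toℕ-fin c<n , trans (T-symbol e (subst (_< n) (sym fr+fc≡r+c) r+c<n)) fr+fc≡r+c , e
    where
    r<n : r < n
    r<n = ≤-<-trans (m≤m+n r c) r+c<n
    c<n : c < n
    c<n = ≤-<-trans (m≤n+m c r) r+c<n
    fr fc : Fin n
    fr = fin r<n
    fc = fin c<n
    fr+fc≡r+c : toℕ fr + toℕ fc ≡ r + c
    fr+fc≡r+c = cong₂ _+_ (toℕ-fin r<n) (toℕ-fin c<n)
    e : T fr fc ≡ just ((toℕ fr + toℕ fc) mod n)
    e = T-intro {fr} {fc} (subst₂ (Occupied g) (sym (toℕ-fin r<n)) (sym (toℕ-fin c<n)) o)

corner-InT0 : ∀ {m r c} → Corner m r c → InT0 m r c (r + c)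
corner-InT0 {m} (inj₁ refl , inj₁ refl) = inj₁ (refl , refl , refl)
corner-InT0 {m} (inj₂ refl , inj₁ refl) = inj₂ (inj₁ (refl , refl , +-identityʳ m))
corner-InT0 {m} (inj₂ refl , inj₂ refl) = inj₂ (inj₂ (inj₁ (refl , refl , cong (m +_) (sym (+-identityʳ m)))))
corner-InT0 {m} (inj₁ refl , inj₂ refl) = inj₂ (inj₂ (inj₂ (refl , refl , refl)))

module TradePatch {m n₀ : ℕ} (m>0 : 0 < m) (3m≤n : 3 * m ≤ suc n₀) where
  private
    n : ℕ
    n = suc n₀
    g : Patch
    g = tradePatch m n
    2m<n : m + m < n
    2m<n = <-≤-trans (+-monoʳ-< m (m<m+n m (<-≤-trans m>0 (m≤m+n m 0)))) 3m≤n
    m<n : m < n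
    m<n = <-trans (m<m+n m m>0) 2m<n
    corner-sum : ∀ {r c} → Corner m r c → r + c < n
    corner-sum (r∈ , c∈) = ≤-<-trans (+-mono-≤ (≤m r∈) (≤m c∈)) 2m<n
      where
      ≤m : ∀ {k} → k ≡ 0 ⊎ k ≡ m → k ≤ m
      ≤m (inj₁ refl) = z≤n
      ≤m (inj₂ refl) = ≤-refl
    placed : ∀ {r c t} → g r c ≡ just t → r ≤ m × (Corner m r c ⊎ (m + m ≤ c × c + m ≤ n))
    placed = tradePatch-placed m>0 3m≤n

    inside : ∀ {r c} → Occupied g r c → r < n × c < n × r + c ≤ n
    inside {r} {c} (_ , e) with placed e
    ... | r≤m , inj₁ corner = let r+c<n = corner-sum corner in
      ≤-<-trans (m≤m+n r c) r+c<n , ≤-<-trans (m≤n+m c r) r+c<n , <⇒≤ r+c<n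
    ... | r≤m , inj₂ (_ , c+m≤n) =
      ≤-<-trans r≤m m<n , <-≤-trans (m<m+n c m>0) c+m≤n , ≤-trans (≤-reflexive (+-comm r c)) (≤-trans (+-monoʳ-≤ c r≤m) c+m≤n)

    rim : ∀ {r c} → Occupied g r c → r + c ≡ n → r ≡ m
    rim {r} {c} (_ , e) r+c≡n with placed e
    ... | _ , inj₁ corner = ⊥-elim (<⇒≢ (corner-sum corner) r+c≡n)
    ... | r≤m , inj₂ (_ , c+m≤n) =
      ≤-antisym r≤m (+-cancelˡ-≤ c m r (≤-trans c+m≤n (≤-reflexive (trans (sym r+c≡n) (+-comm r c)))))

  open Closing (tradePatch-bridge m>0 3m≤n) m>0 inside rim public

  private
    off-column-0 : ∀ {r} → ¬ Occupied (columnSwap m 0 0) r m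
    off-column-0 (_ , e) = <⇒≢ m>0 (sym (proj₁ (columnSwap-cases m 0 0 e)))
    g00 : Occupied g 0 0
    g00 = _ , ∪-introˡ (columnSwap m 0 0) _ (columnSwap-top m 0 0)
    gm0 : Occupied g m 0
    gm0 = _ , ∪-introˡ (columnSwap m 0 0) _ (columnSwap-bottom 0 0 m>0)
    g0m : Occupied g 0 m
    g0m = _ , ∪-introʳ (columnSwap m 0 0) _ off-column-0 (∪-introˡ (columnSwap m 0 m) _ (columnSwap-top m 0 m))
    gmm : Occupied g m m
    gmm = _ , ∪-introʳ (columnSwap m 0 0) _ off-column-0 (∪-introˡ (columnSwap m 0 m) _ (columnSwap-bottom 0 m m>0))

  T-corner-entries : HasEntry T 0 0 0 × HasEntry T m 0 m × HasEntry T m m (2 * m) × HasEntry T 0 m m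
  T-corner-entries =
    T-entry (corner-sum (inj₁ refl , inj₁ refl)) g00 ,
    subst (HasEntry T m 0) (+-identityʳ m) (T-entry (corner-sum (inj₂ refl , inj₁ refl)) gm0) ,
    subst (HasEntry T m m) (cong (m +_) (sym (+-identityʳ m))) (T-entry (corner-sum (inj₂ refl , inj₂ refl)) gmm) ,
    T-entry (corner-sum (inj₁ refl , inj₂ refl)) g0m

  T-nonEmpty : NonEmpty T
  T-nonEmpty = let (fr , fc , fs , _ , _ , _ , e) = proj₁ T-corner-entries in fr , fc , fs , e

  T-located : ∀ (r c s : Fin n) → T r c ≡ just s → ¬ InT0 m (toℕ r) (toℕ c) (toℕ s) →
              toℕ r ≤ m × 2 * m ≤ toℕ c × toℕ c ≤ n ∸ m
  T-located r c s e ¬T₀ with placed (proj₂ (proj₁ (T-cases {r} {c} e)))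
  ... | _ , inj₁ corner = ⊥-elim (¬T₀ (subst (InT0 m _ _) (sym (T-symbol e (corner-sum corner))) (corner-InT0 corner)))
  ... | r≤m , inj₂ (2m≤c , c+m≤n) =
    r≤m , subst (_≤ toℕ c) (cong (m +_) (sym (+-identityʳ m))) 2m≤c , m+n≤o⇒m≤o∸n (toℕ c) c+m≤n

lemma11 : (m n : ℕ) → 1 ≤ m → 3 * m < n →
    ∃[ T ] (IsLatinTradeInB {n} T ×
    HasEntry T 0 0 0 × HasEntry T m 0 m × HasEntry T m m (2 * m) × HasEntry T 0 m m ×
    (∀ (r c s : Fin n) → T r c ≡ just s → ¬ InT0 m (toℕ r) (toℕ c) (toℕ s) →
    toℕ r ≤ m × 2 * m ≤ toℕ c × toℕ c ≤ n ∸ m))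
lemma11 m zero _ ()
lemma11 m (suc n₀) m>0 3m<n =
  let (e₀₀ , eₘ₀ , eₘₘ , e₀ₘ) = T-corner-entries in
  T , T-trade T-nonEmpty , e₀₀ , eₘ₀ , eₘₘ , e₀ₘ , T-located
  where open TradePatch m>0 (<⇒≤ 3m<n)
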